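{- Let $k>0$ be an integer and let $G\cong\{a\mid b\}$ where $a$, $b$, $G$ are numbers. If $b-G\le1$ and, for $i=1,\dots,k$, $\alpha_i>0$ is the least integer such that $2^{ -\alpha_i}<b-G-\sum_{j=1}^{i-1}2^{ -\alpha_j}$, then \[G\mathbin{:}k=G+\sum_{i=1}^k\frac{1}{2^{\alpha_i}}.\] Similarly, if $G-a\le1$ and, for $i=1,\dots,k$, $\beta_i$ is the least (positive) integer such that $2^{ -\beta_i}<G-a-\sum_{j=1}^{i-1}2^{ -\beta_j}$, then \[G\mathbin{:}(-k)=G-\sum_{i=1}^k\frac{1}{2^{\beta_i}}.\]
   Context: Games are short normal-play combinatorial games with the usual disjunctive sum, order and equality; numbers are games whose options are numbers and whose Left options are all strictly less than its Right options, with values identified with dyadic rationals. Integers $k$ and $-k$ are in canonical form ($0\cong\{\mid\}$, $k+1\cong\{k\mid\}$, $-k\cong\{\mid-k+1\}$). The ordinal sum is $G\mathbin{:}H\cong\{L(G),G\mathbin{:}H^L\mid R(G),G\mathbin{:}H^R\}$. -}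

module Defs where

open import Data.List using (List; []; _∷_; [_]; _++_)
open import Data.List.Relation.Unary.All using (All)
open import Data.List.Relation.Unary.Any using (Any)
open import Data.List.Membership.Propositional using (_∈_)
open import Data.Nat using (ℕ; zero; suc)
open import Data.Product using (_×_)
open import Relation.Nullary using (¬_)

-- Short games: finitely many Left and Right options.
data Game : Set where
  ⟨_∣_⟩ : List Game → List Game → Game

-- Conway's order: G ≤ H iff no G^L ≥ H and no H^R ≤ G.
-- Written positively via the "less or fuzzy" relation G ⧏ H  (= ¬ (H ≤ G)):
--   G ⧏ H iff G ≤ H^L for some H^L, or G^R ≤ H for some G^R.
data _≤_ : Game → Game → Set
data _⧏_ : Game → Game → Set

data _≤_ where
  le : ∀ {GL GR HL HR} →
       All (λ x → x ⧏ ⟨ HL ∣ HR ⟩) GL →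
       All (λ y → ⟨ GL ∣ GR ⟩ ⧏ y) HR →
       ⟨ GL ∣ GR ⟩ ≤ ⟨ HL ∣ HR ⟩

data _⧏_ where
  lfL : ∀ {G HL HR} → Any (λ x → G ≤ x) HL → G ⧏ ⟨ HL ∣ HR ⟩
  lfR : ∀ {GL GR H} → Any (λ y → y ≤ H) GR → ⟨ GL ∣ GR ⟩ ⧏ H

infix 4 _≤_ _⧏_ _<_ _≈_

_<_ : Game → Game → Set
G < H = G ≤ H × ¬ (H ≤ G)

_≈_ : Game → Game → Set
G ≈ H = G ≤ H × H ≤ G

data IsNumber : Game → Set where
  num : ∀ {L R} → All IsNumber L → All IsNumber R →
        (∀ {x y} → x ∈ L → y ∈ R → x < y) → IsNumber ⟨ L ∣ R ⟩

infixl 6 _+_ _-_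
_+_ : Game → Game → Game
addL : List Game → Game → List Game
addR : Game → List Game → List Game

⟨ GL ∣ GR ⟩ + ⟨ HL ∣ HR ⟩ =
  ⟨ addL GL ⟨ HL ∣ HR ⟩ ++ addR ⟨ GL ∣ GR ⟩ HL
  ∣ addL GR ⟨ HL ∣ HR ⟩ ++ addR ⟨ GL ∣ GR ⟩ HR ⟩

addL [] H = []
addL (x ∷ xs) H = (x + H) ∷ addL xs H

addR G [] = []
addR G (y ∷ ys) = (G + y) ∷ addR G ys

-_ : Game → Game
negs : List Game → List Game
- ⟨ GL ∣ GR ⟩ = ⟨ negs GR ∣ negs GL ⟩
negs [] = []
negs (x ∷ xs) = (- x) ∷ negs xs

_-_ : Game → Game → Game
G - H = G + (- H)

_∶_ : Game → Game → Game
ordL : Game → List Game → List Game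
G ∶ ⟨ HL ∣ HR ⟩ with G
... | ⟨ GL ∣ GR ⟩ = ⟨ GL ++ ordL G HL ∣ GR ++ ordL G HR ⟩
ordL G [] = []
ordL G (y ∷ ys) = (G ∶ y) ∷ ordL G ys

zeroG : Game
zeroG = ⟨ [] ∣ [] ⟩

natG : ℕ → Game
natG zero = zeroG
natG (suc n) = ⟨ [ natG n ] ∣ [] ⟩

negNatG : ℕ → Game
negNatG zero = zeroG
negNatG (suc n) = ⟨ [] ∣ [ negNatG n ] ⟩

pow2inv : ℕ → Game
pow2inv zero = natG 1
pow2inv (suc n) = ⟨ [ zeroG ] ∣ [ pow2inv n ] ⟩

-- partial sums  psum α i = Σ_{j < i} 2^{-α j}   (indices shifted to start at 0)
psum : (ℕ → ℕ) → ℕ → Game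
psum α zero = zeroG
psum α (suc i) = psum α i + pow2inv (α i)

IsGreedyExpansion : ℕ → Game → (ℕ → ℕ) → Set
IsGreedyExpansion k D α =
  ∀ i → suc i Data.Nat.≤ k →
    (1 Data.Nat.≤ α i) ×
    (pow2inv (α i) < D - psum α i) ×
    (∀ m → 1 Data.Nat.≤ m → m Data.Nat.< α i → ¬ (pow2inv m < D - psum α i))

-- Every short number equals a canonical dyadic n/2^E whose options all lie at distance at
-- least 2^-E from it. For G = {a | b} with E minimal, b − G ≤ 2^-E: for E = 0 this is the
-- hypothesis, and for E > 0 a dyadic simpler than G would otherwise lie strictly between
-- a and b. Writing T = G + Σ_{i<j} 2^-α_i, the game G : (j+1) = {a, G : j | b} is compared
-- with T + 2^-α_j: the greedy choice gives T + 2^-α_j < b ≤ T + 2^(1-α_j), and since the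
-- exponents α_i increase from a value beyond E, T has a representative whose options are
-- 2^-α_j away, so every option of T + 2^-α_j is dominated by G : j or by b. The case
-- G : (-k) follows by negation.

module Submission where

open import Defs
open import Data.Nat using (ℕ; zero; suc; z≤n; s≤s; _⊔_; _≤′_; ≤′-refl; ≤′-step)
  renaming (_+_ to _+ℕ_; _≤_ to _≤ℕ_; _<_ to _<ℕ_)
import Data.Nat.Properties as ℕ
open import Data.Integer using (ℤ; +_; -[1+_])
import Data.Integer as ℤ
import Data.Integer.Properties as ℤ
import Data.Integer.DivMod as ℤ
open import Data.Integer.Tactic.RingSolver using (solve-∀)
open import Data.List using (List; []; _∷_; _++_; [_])
open import Data.List.Relation.Unary.All using (All; []; _∷_) renaming (tabulate to tabulateAll; lookup to lookupAll)
import Data.List.Relation.Unary.All as All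
import Data.List.Relation.Unary.All.Properties as All
open import Data.List.Relation.Unary.Any using (Any; here; there)
import Data.List.Relation.Unary.Any.Properties as Any
open import Data.List.Membership.Propositional using (_∈_; find; lose)
open import Data.Product using (_×_; _,_; proj₁; proj₂; ∃; ∃₂)
open import Data.Sum using (_⊎_; inj₁; inj₂; [_,_]′)
open import Data.Empty using (⊥-elim)
open import Function using (case_of_)
open import Relation.Nullary using (¬_; yes; no)
open import Relation.Binary.Bundles using (Poset)
open import Relation.Binary.Structures using (IsPartialOrder)
import Relation.Binary.Reasoning.PartialOrder as PartialOrderReasoning
open import Relation.Binary.PropositionalEquality using (_≡_; refl; sym; trans; cong; cong₂; subst; subst₂)

lefts rights : Game → List Game
lefts ⟨ L ∣ _ ⟩ = L
rights ⟨ _ ∣ R ⟩ = R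

game-ind : (P : Game → Set) →
  (∀ x → (∀ {l} → l ∈ lefts x → P l) → (∀ {r} → r ∈ rights x → P r) → P x) →
  ∀ x → P x
game-ind P step = go
  where
  go : ∀ x → P x
  go-∈ : ∀ {g} (xs : List Game) → g ∈ xs → P g
  go ⟨ L ∣ R ⟩ = step ⟨ L ∣ R ⟩ (go-∈ L) (go-∈ R)
  go-∈ (x ∷ _) (here refl) = go x
  go-∈ (_ ∷ xs) (there m) = go-∈ xs m

-- Order and equivalence

≤⁺ : ∀ {G H} → All (_⧏ H) (lefts G) → All (G ⧏_) (rights H) → G ≤ H
≤⁺ {⟨ _ ∣ _ ⟩} {⟨ _ ∣ _ ⟩} = le

≤⁻ˡ : ∀ {G H l} → G ≤ H → l ∈ lefts G → l ⧏ H
≤⁻ˡ (le ls _) m = lookupAll ls m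

≤⁻ʳ : ∀ {G H r} → G ≤ H → r ∈ rights H → G ⧏ r
≤⁻ʳ (le _ rs) m = lookupAll rs m

⧏⁺ˡ : ∀ {G H l} → l ∈ lefts H → G ≤ l → G ⧏ H
⧏⁺ˡ {H = ⟨ _ ∣ _ ⟩} m p = lfL (lose m p)

⧏⁺ʳ : ∀ {G H r} → r ∈ rights G → r ≤ H → G ⧏ H
⧏⁺ʳ {G = ⟨ _ ∣ _ ⟩} m p = lfR (lose m p)

⧏⁻ : ∀ {G H} → G ⧏ H → (∃ λ l → l ∈ lefts H × G ≤ l) ⊎ (∃ λ r → r ∈ rights G × r ≤ H)
⧏⁻ (lfL p) = inj₁ (find p)
⧏⁻ (lfR p) = inj₂ (find p)

≤-refl : ∀ x → x ≤ x
≤-refl = game-ind (λ x → x ≤ x) λ _ ihL ihR →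
  ≤⁺ (tabulateAll λ m → ⧏⁺ˡ m (ihL m)) (tabulateAll λ m → ⧏⁺ʳ m (ihR m))

≤-trans : ∀ {x y z} → x ≤ y → y ≤ z → x ≤ z
⧏-≤-trans : ∀ {x y z} → x ⧏ y → y ≤ z → x ⧏ z
≤-⧏-trans : ∀ {x y z} → x ≤ y → y ⧏ z → x ⧏ z
all-⧏-≤-trans : ∀ {y z} {xs : List Game} → All (_⧏ y) xs → y ≤ z → All (_⧏ z) xs
all-≤-⧏-trans : ∀ {x y} {zs : List Game} → x ≤ y → All (y ⧏_) zs → All (x ⧏_) zs
any-≤-trans : ∀ {y z} {xs : List Game} → Any (_≤ y) xs → y ≤ z → Any (_≤ z) xs
≤-any-trans : ∀ {x y} {zs : List Game} → x ≤ y → Any (y ≤_) zs → Any (x ≤_) zs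
any-all-⧏ : ∀ {x z} {ys : List Game} → Any (x ≤_) ys → All (_⧏ z) ys → x ⧏ z
all-any-⧏ : ∀ {x z} {ys : List Game} → All (x ⧏_) ys → Any (_≤ z) ys → x ⧏ z

≤-trans xy@(le xl _) yz@(le _ zr) = le (all-⧏-≤-trans xl yz) (all-≤-⧏-trans xy zr)
⧏-≤-trans (lfL p) (le yl _) = any-all-⧏ p yl
⧏-≤-trans (lfR p) yz = lfR (any-≤-trans p yz)
≤-⧏-trans xy (lfL p) = lfL (≤-any-trans xy p)
≤-⧏-trans (le _ xr) (lfR p) = all-any-⧏ xr p
all-⧏-≤-trans [] yz = []
all-⧏-≤-trans (p ∷ ps) yz = ⧏-≤-trans p yz ∷ all-⧏-≤-trans ps yz
all-≤-⧏-trans xy [] = []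
all-≤-⧏-trans xy (p ∷ ps) = ≤-⧏-trans xy p ∷ all-≤-⧏-trans xy ps
any-≤-trans (here p) yz = here (≤-trans p yz)
any-≤-trans (there p) yz = there (any-≤-trans p yz)
≤-any-trans xy (here p) = here (≤-trans xy p)
≤-any-trans xy (there p) = there (≤-any-trans xy p)
any-all-⧏ (here p) (q ∷ _) = ≤-⧏-trans p q
any-all-⧏ (there p) (_ ∷ qs) = any-all-⧏ p qs
all-any-⧏ (q ∷ _) (here p) = ⧏-≤-trans q p
all-any-⧏ (_ ∷ qs) (there p) = all-any-⧏ qs p

≤⊎⧏ : ∀ x y → x ≤ y ⊎ y ⧏ x
all⊎any-≤ : ∀ y (xs : List Game) → All (_⧏ y) xs ⊎ Any (y ≤_) xs
all⊎any-≥ : ∀ x (ys : List Game) → All (x ⧏_) ys ⊎ Any (_≤ x) ys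
≤⊎⧏ ⟨ XL ∣ XR ⟩ ⟨ YL ∣ YR ⟩ with all⊎any-≤ ⟨ YL ∣ YR ⟩ XL | all⊎any-≥ ⟨ XL ∣ XR ⟩ YR
... | inj₁ ls | inj₁ rs = inj₁ (le ls rs)
... | inj₂ p | _ = inj₂ (lfL p)
... | inj₁ _ | inj₂ p = inj₂ (lfR p)
all⊎any-≤ y [] = inj₁ []
all⊎any-≤ y (x ∷ xs) with ≤⊎⧏ y x | all⊎any-≤ y xs
... | inj₁ p | _ = inj₂ (here p)
... | inj₂ q | inj₁ qs = inj₁ (q ∷ qs)
... | inj₂ _ | inj₂ p = inj₂ (there p)
all⊎any-≥ x [] = inj₁ []
all⊎any-≥ x (y ∷ ys) with ≤⊎⧏ y x | all⊎any-≥ x ys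
... | inj₁ p | _ = inj₂ (here p)
... | inj₂ q | inj₁ qs = inj₁ (q ∷ qs)
... | inj₂ _ | inj₂ p = inj₂ (there p)

⧏⇒≱ : ∀ {x y} → x ⧏ y → ¬ (y ≤ x)
all-any-⊥ˡ : ∀ {y} {xs : List Game} → All (_⧏ y) xs → ¬ Any (y ≤_) xs
all-any-⊥ʳ : ∀ {x} {ys : List Game} → All (x ⧏_) ys → ¬ Any (_≤ x) ys
⧏⇒≱ (lfL p) (le yl _) = all-any-⊥ˡ yl p
⧏⇒≱ (lfR p) (le _ yr) = all-any-⊥ʳ yr p
all-any-⊥ˡ (q ∷ _) (here p) = ⧏⇒≱ q p
all-any-⊥ˡ (_ ∷ qs) (there p) = all-any-⊥ˡ qs p
all-any-⊥ʳ (q ∷ _) (here p) = ⧏⇒≱ q p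
all-any-⊥ʳ (_ ∷ qs) (there p) = all-any-⊥ʳ qs p

≱⇒⧏ : ∀ {x y} → ¬ (y ≤ x) → x ⧏ y
≱⇒⧏ {x} {y} y≰x with ≤⊎⧏ y x
... | inj₁ y≤x = ⊥-elim (y≰x y≤x)
... | inj₂ x⧏y = x⧏y

≈-refl : ∀ x → x ≈ x
≈-refl x = ≤-refl x , ≤-refl x

≈-sym : ∀ {x y} → x ≈ y → y ≈ x
≈-sym (p , q) = q , p

≈-trans : ∀ {x y z} → x ≈ y → y ≈ z → x ≈ z
≈-trans (p , q) (r , s) = ≤-trans p r , ≤-trans s q

≤-isPartialOrder : IsPartialOrder _≈_ _≤_
≤-isPartialOrder = record
  { isPreorder = record
    { isEquivalence = record { refl = ≈-refl _ ; sym = ≈-sym ; trans = ≈-trans }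
    ; reflexive = proj₁
    ; trans = ≤-trans
    }
  ; antisym = _,_
  }

≤-poset : Poset _ _ _
≤-poset = record { isPartialOrder = ≤-isPartialOrder }

module ≤-Reasoning = PartialOrderReasoning ≤-poset

<⇒⧏ : ∀ {x y} → x < y → x ⧏ y
<⇒⧏ (_ , y≰x) = ≱⇒⧏ y≰x

<⇒≤ : ∀ {x y} → x < y → x ≤ y
<⇒≤ = proj₁

<-≤-trans : ∀ {x y z} → x < y → y ≤ z → x < z
<-≤-trans (p , y≰x) q = ≤-trans p q , λ z≤x → y≰x (≤-trans q z≤x)

≤-<-trans : ∀ {x y z} → x ≤ y → y < z → x < z
≤-<-trans p (q , z≰y) = ≤-trans p q , λ z≤x → z≰y (≤-trans z≤x p)

<-trans : ∀ {x y z} → x < y → y < z → x < z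
<-trans p q = <-≤-trans p (<⇒≤ q)

<-respˡ-≈ : ∀ {x x′ y} → x ≈ x′ → x < y → x′ < y
<-respˡ-≈ (_ , q) p = ≤-<-trans q p

<-respʳ-≈ : ∀ {x y y′} → y ≈ y′ → x < y → x < y′
<-respʳ-≈ (q , _) p = <-≤-trans p q

-- The group of games

∈-addL : ∀ {g y} {xs : List Game} → g ∈ xs → g + y ∈ addL xs y
∈-addL (here refl) = here refl
∈-addL (there m) = there (∈-addL m)

∈-addR : ∀ {g x} {ys : List Game} → g ∈ ys → x + g ∈ addR x ys
∈-addR (here refl) = here refl
∈-addR (there m) = there (∈-addR m)

∈-negs : ∀ {g} {xs : List Game} → g ∈ xs → - g ∈ negs xs
∈-negs (here refl) = here refl
∈-negs (there m) = there (∈-negs m)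

∈-addL⁻ : ∀ {g y} (xs : List Game) → g ∈ addL xs y → ∃ λ h → h ∈ xs × g ≡ h + y
∈-addL⁻ (h ∷ _) (here refl) = h , here refl , refl
∈-addL⁻ (_ ∷ xs) (there m) with ∈-addL⁻ xs m
... | h , m′ , e = h , there m′ , e

∈-addR⁻ : ∀ {g x} (ys : List Game) → g ∈ addR x ys → ∃ λ h → h ∈ ys × g ≡ x + h
∈-addR⁻ (h ∷ _) (here refl) = h , here refl , refl
∈-addR⁻ (_ ∷ ys) (there m) with ∈-addR⁻ ys m
... | h , m′ , e = h , there m′ , e

∈-negs⁻ : ∀ {g} (xs : List Game) → g ∈ negs xs → ∃ λ h → h ∈ xs × g ≡ - h
∈-negs⁻ (h ∷ _) (here refl) = h , here refl , refl
∈-negs⁻ (_ ∷ xs) (there m) with ∈-negs⁻ xs m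
... | h , m′ , e = h , there m′ , e

+-leftˡ : ∀ x y {l} → l ∈ lefts x → l + y ∈ lefts (x + y)
+-leftˡ ⟨ _ ∣ _ ⟩ ⟨ _ ∣ _ ⟩ m = Any.++⁺ˡ (∈-addL m)

+-leftʳ : ∀ x y {l} → l ∈ lefts y → x + l ∈ lefts (x + y)
+-leftʳ ⟨ XL ∣ _ ⟩ ⟨ _ ∣ _ ⟩ m = Any.++⁺ʳ (addL XL _) (∈-addR m)

+-rightˡ : ∀ x y {r} → r ∈ rights x → r + y ∈ rights (x + y)
+-rightˡ ⟨ _ ∣ _ ⟩ ⟨ _ ∣ _ ⟩ m = Any.++⁺ˡ (∈-addL m)

+-rightʳ : ∀ x y {r} → r ∈ rights y → x + r ∈ rights (x + y)
+-rightʳ ⟨ _ ∣ XR ⟩ ⟨ _ ∣ _ ⟩ m = Any.++⁺ʳ (addL XR _) (∈-addR m)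

neg-left : ∀ x {r} → r ∈ rights x → - r ∈ lefts (- x)
neg-left ⟨ _ ∣ _ ⟩ = ∈-negs

neg-right : ∀ x {l} → l ∈ lefts x → - l ∈ rights (- x)
neg-right ⟨ _ ∣ _ ⟩ = ∈-negs

+-left⁻ : ∀ x y {g} → g ∈ lefts (x + y) →
  (∃ λ l → l ∈ lefts x × g ≡ l + y) ⊎ (∃ λ l → l ∈ lefts y × g ≡ x + l)
+-left⁻ ⟨ XL ∣ _ ⟩ ⟨ YL ∣ _ ⟩ m with Any.++⁻ (addL XL _) m
... | inj₁ m′ = inj₁ (∈-addL⁻ XL m′)
... | inj₂ m′ = inj₂ (∈-addR⁻ YL m′)

+-right⁻ : ∀ x y {g} → g ∈ rights (x + y) →
  (∃ λ r → r ∈ rights x × g ≡ r + y) ⊎ (∃ λ r → r ∈ rights y × g ≡ x + r)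
+-right⁻ ⟨ _ ∣ XR ⟩ ⟨ _ ∣ YR ⟩ m with Any.++⁻ (addL XR _) m
... | inj₁ m′ = inj₁ (∈-addL⁻ XR m′)
... | inj₂ m′ = inj₂ (∈-addR⁻ YR m′)

neg-left⁻ : ∀ x {g} → g ∈ lefts (- x) → ∃ λ r → r ∈ rights x × g ≡ - r
neg-left⁻ ⟨ _ ∣ XR ⟩ = ∈-negs⁻ XR

neg-right⁻ : ∀ x {g} → g ∈ rights (- x) → ∃ λ l → l ∈ lefts x × g ≡ - l
neg-right⁻ ⟨ XL ∣ _ ⟩ = ∈-negs⁻ XL

+-left-elim : ∀ {P : Game → Set} x y →
  (∀ {l} → l ∈ lefts x → P (l + y)) → (∀ {l} → l ∈ lefts y → P (x + l)) → All P (lefts (x + y))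
+-left-elim x y f g = tabulateAll λ m →
  [ (λ { (_ , l∈ , refl) → f l∈ }) , (λ { (_ , l∈ , refl) → g l∈ }) ]′ (+-left⁻ x y m)

+-right-elim : ∀ {P : Game → Set} x y →
  (∀ {r} → r ∈ rights x → P (r + y)) → (∀ {r} → r ∈ rights y → P (x + r)) → All P (rights (x + y))
+-right-elim x y f g = tabulateAll λ m →
  [ (λ { (_ , r∈ , refl) → f r∈ }) , (λ { (_ , r∈ , refl) → g r∈ }) ]′ (+-right⁻ x y m)

neg-left-elim : ∀ {P : Game → Set} x → (∀ {r} → r ∈ rights x → P (- r)) → All P (lefts (- x))
neg-left-elim x f = tabulateAll λ m → case neg-left⁻ x m of λ { (_ , r∈ , refl) → f r∈ }

neg-right-elim : ∀ {P : Game → Set} x → (∀ {l} → l ∈ lefts x → P (- l)) → All P (rights (- x))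
neg-right-elim x f = tabulateAll λ m → case neg-right⁻ x m of λ { (_ , l∈ , refl) → f l∈ }

+-mono-≤-⧏ : ∀ x x′ y → (x ≤ x′ → x + y ≤ x′ + y) × (x ⧏ x′ → x + y ⧏ x′ + y)
+-mono-≤-⧏ = game-ind (λ x → ∀ x′ y → Mono x x′ y) λ x ihL ihR →
  game-ind (λ x′ → ∀ y → Mono x x′ y) λ x′ ih′L ih′R →
  game-ind (λ y → Mono x x′ y) λ y jL jR →
    (λ x≤x′ → ≤⁺
       (+-left-elim x y (λ m → proj₂ (ihL m x′ y) (≤⁻ˡ x≤x′ m))
                        (λ m → ⧏⁺ˡ (+-leftʳ x′ y m) (proj₁ (jL m) x≤x′)))
       (+-right-elim x′ y (λ m → proj₂ (ih′R m y) (≤⁻ʳ x≤x′ m))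
                          (λ m → ⧏⁺ʳ (+-rightʳ x y m) (proj₁ (jR m) x≤x′)))) ,
    (λ x⧏x′ → [ (λ { (_ , m , x≤l) → ⧏⁺ˡ (+-leftˡ x′ y m) (proj₁ (ih′L m y) x≤l) })
              , (λ { (_ , m , r≤x′) → ⧏⁺ʳ (+-rightˡ x y m) (proj₁ (ihR m x′ y) r≤x′) })
              ]′ (⧏⁻ x⧏x′))
  where
  Mono : Game → Game → Game → Set
  Mono x x′ y = (x ≤ x′ → x + y ≤ x′ + y) × (x ⧏ x′ → x + y ⧏ x′ + y)

+-monoˡ-≤ : ∀ {x x′} y → x ≤ x′ → x + y ≤ x′ + y
+-monoˡ-≤ {x} {x′} y = proj₁ (+-mono-≤-⧏ x x′ y)

+-comm-≤ : ∀ x y → x + y ≤ y + x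
+-comm-≤ = game-ind (λ x → ∀ y → x + y ≤ y + x) λ x ihL ihR →
  game-ind (λ y → x + y ≤ y + x) λ y jL jR →
    ≤⁺ (+-left-elim x y (λ m → ⧏⁺ˡ (+-leftʳ y x m) (ihL m y)) (λ m → ⧏⁺ˡ (+-leftˡ y x m) (jL m)))
       (+-right-elim y x (λ m → ⧏⁺ʳ (+-rightʳ x y m) (jR m)) (λ m → ⧏⁺ʳ (+-rightˡ x y m) (ihR m y)))

+-comm : ∀ x y → x + y ≈ y + x
+-comm x y = +-comm-≤ x y , +-comm-≤ y x

+-monoʳ-≤ : ∀ x {y y′} → y ≤ y′ → x + y ≤ x + y′
+-monoʳ-≤ x {y} {y′} p = ≤-trans (+-comm-≤ x y) (≤-trans (+-monoˡ-≤ x p) (+-comm-≤ y′ x))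

+-mono-≤ : ∀ {x x′ y y′} → x ≤ x′ → y ≤ y′ → x + y ≤ x′ + y′
+-mono-≤ {x′ = x′} {y = y} p q = ≤-trans (+-monoˡ-≤ y p) (+-monoʳ-≤ x′ q)

+-cong : ∀ {x x′ y y′} → x ≈ x′ → y ≈ y′ → x + y ≈ x′ + y′
+-cong (p , p′) (q , q′) = +-mono-≤ p q , +-mono-≤ p′ q′

+-congˡ : ∀ x {y y′} → y ≈ y′ → x + y ≈ x + y′
+-congˡ x = +-cong (≈-refl x)

+-congʳ : ∀ y {x x′} → x ≈ x′ → x + y ≈ x′ + y
+-congʳ y p = +-cong p (≈-refl y)

+-assoc-≤ : ∀ x y z → (x + y) + z ≤ x + (y + z)
+-assoc-≤ = game-ind (λ x → ∀ y z → (x + y) + z ≤ x + (y + z)) λ x ixL ixR →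
  game-ind (λ y → ∀ z → (x + y) + z ≤ x + (y + z)) λ y iyL iyR →
  game-ind (λ z → (x + y) + z ≤ x + (y + z)) λ z izL izR →
    ≤⁺ (+-left-elim (x + y) z
          (lookupAll (+-left-elim {P = λ l → l + z ⧏ x + (y + z)} x y
            (λ m → ⧏⁺ˡ (+-leftˡ x (y + z) m) (ixL m y z))
            (λ m → ⧏⁺ˡ (+-leftʳ x (y + z) (+-leftˡ y z m)) (iyL m z))))
          (λ m → ⧏⁺ˡ (+-leftʳ x (y + z) (+-leftʳ y z m)) (izL m)))
       (+-right-elim x (y + z)
          (λ m → ⧏⁺ʳ (+-rightˡ (x + y) z (+-rightˡ x y m)) (ixR m y z))
          (lookupAll (+-right-elim {P = λ r → (x + y) + z ⧏ x + r} y z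
            (λ m → ⧏⁺ʳ (+-rightˡ (x + y) z (+-rightʳ x y m)) (iyR m z))
            (λ m → ⧏⁺ʳ (+-rightʳ (x + y) z m) (izR m)))))

+-assoc : ∀ x y z → (x + y) + z ≈ x + (y + z)
+-assoc x y z = +-assoc-≤ x y z , (begin
  x + (y + z) ≤⟨ +-comm-≤ x (y + z) ⟩
  (y + z) + x ≤⟨ +-monoˡ-≤ x (+-comm-≤ y z) ⟩
  (z + y) + x ≤⟨ +-assoc-≤ z y x ⟩
  z + (y + x) ≤⟨ +-comm-≤ z (y + x) ⟩
  (y + x) + z ≤⟨ +-monoˡ-≤ z (+-comm-≤ y x) ⟩
  (x + y) + z ∎)
  where open ≤-Reasoning

+-identityʳ : ∀ x → x + zeroG ≈ x
+-identityʳ = game-ind (λ x → x + zeroG ≈ x) λ x ihL ihR →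
  ≤⁺ (+-left-elim x zeroG (λ m → ⧏⁺ˡ m (proj₁ (ihL m))) λ ())
     (tabulateAll λ m → ⧏⁺ʳ (+-rightˡ x zeroG m) (proj₁ (ihR m))) ,
  ≤⁺ (tabulateAll λ m → ⧏⁺ˡ (+-leftˡ x zeroG m) (proj₂ (ihL m)))
     (+-right-elim x zeroG (λ m → ⧏⁺ʳ m (proj₂ (ihR m))) λ ())

+-identityˡ : ∀ x → zeroG + x ≈ x
+-identityˡ x = ≈-trans (+-comm zeroG x) (+-identityʳ x)

+-inverseʳ : ∀ x → x - x ≈ zeroG
+-inverseʳ = game-ind (λ x → x - x ≈ zeroG) λ x ihL ihR →
  ≤⁺ (+-left-elim x (- x)
        (λ m → ⧏⁺ʳ (+-rightʳ _ (- x) (neg-right x m)) (proj₁ (ihL m)))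
        (lookupAll (neg-left-elim {P = λ l → x + l ⧏ zeroG} x
          (λ m → ⧏⁺ʳ (+-rightˡ x _ m) (proj₁ (ihR m))))))
     [] ,
  ≤⁺ []
     (+-right-elim x (- x)
        (λ m → ⧏⁺ˡ (+-leftʳ _ (- x) (neg-left x m)) (proj₂ (ihR m)))
        (lookupAll (neg-right-elim {P = λ r → zeroG ⧏ x + r} x
          (λ m → ⧏⁺ˡ (+-leftˡ x _ m) (proj₂ (ihL m))))))

+-inverseˡ : ∀ x → - x + x ≈ zeroG
+-inverseˡ x = ≈-trans (+-comm (- x) x) (+-inverseʳ x)

neg-involutive : ∀ x → - (- x) ≡ x
negs-involutive : ∀ xs → negs (negs xs) ≡ xs
neg-involutive ⟨ L ∣ R ⟩ = cong₂ ⟨_∣_⟩ (negs-involutive L) (negs-involutive R)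
negs-involutive [] = refl
negs-involutive (x ∷ xs) = cong₂ _∷_ (neg-involutive x) (negs-involutive xs)

negs-++ : ∀ xs ys → negs (xs ++ ys) ≡ negs xs ++ negs ys
negs-++ [] ys = refl
negs-++ (x ∷ xs) ys = cong (- x ∷_) (negs-++ xs ys)

neg-distrib-+ : ∀ x y → - (x + y) ≡ - x + - y
negs-addL : ∀ xs y → negs (addL xs y) ≡ addL (negs xs) (- y)
negs-addR : ∀ x ys → negs (addR x ys) ≡ addR (- x) (negs ys)
neg-distrib-+ ⟨ XL ∣ XR ⟩ y@(⟨ YL ∣ YR ⟩) = cong₂ ⟨_∣_⟩
  (trans (negs-++ (addL XR y) _) (cong₂ _++_ (negs-addL XR y) (negs-addR _ YR)))
  (trans (negs-++ (addL XL y) _) (cong₂ _++_ (negs-addL XL y) (negs-addR _ YL)))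
negs-addL [] y = refl
negs-addL (g ∷ gs) y = cong₂ _∷_ (neg-distrib-+ g y) (negs-addL gs y)
negs-addR x [] = refl
negs-addR x (g ∷ gs) = cong₂ _∷_ (neg-distrib-+ x g) (negs-addR x gs)

neg-antimono-≤-⧏ : ∀ x y → (x ≤ y → - y ≤ - x) × (x ⧏ y → - y ⧏ - x)
neg-antimono-≤-⧏ = game-ind (λ x → ∀ y → (x ≤ y → - y ≤ - x) × (x ⧏ y → - y ⧏ - x))
  λ x ihL ihR → game-ind (λ y → (x ≤ y → - y ≤ - x) × (x ⧏ y → - y ⧏ - x))
  λ y jL jR →
    (λ x≤y → ≤⁺ (neg-left-elim y (λ m → proj₂ (jR m) (≤⁻ʳ x≤y m)))
                (neg-right-elim x (λ m → proj₂ (ihL m y) (≤⁻ˡ x≤y m)))) ,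
    (λ x⧏y → [ (λ { (_ , m , x≤l) → ⧏⁺ʳ (neg-right y m) (proj₁ (jL m) x≤l) })
             , (λ { (_ , m , r≤y) → ⧏⁺ˡ (neg-left x m) (proj₁ (ihR m y) r≤y) }) ]′ (⧏⁻ x⧏y))

neg-antimono-≤ : ∀ {x y} → x ≤ y → - y ≤ - x
neg-antimono-≤ {x} {y} = proj₁ (neg-antimono-≤-⧏ x y)

neg-cong : ∀ {x y} → x ≈ y → - x ≈ - y
neg-cong (p , q) = neg-antimono-≤ q , neg-antimono-≤ p

neg-antimono-< : ∀ {x y} → x < y → - y < - x
neg-antimono-< {x} {y} (x≤y , y≰x) = neg-antimono-≤ x≤y ,
  λ -x≤-y → y≰x (subst₂ _≤_ (neg-involutive y) (neg-involutive x) (neg-antimono-≤ -x≤-y))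

+-cancelʳ-≤ : ∀ {x y} z → x + z ≤ y + z → x ≤ y
+-cancelʳ-≤ {x} {y} z p = begin
  x               ≈⟨ +-identityʳ x ⟨
  x + zeroG       ≈⟨ +-congˡ x (+-inverseʳ z) ⟨
  x + (z - z)     ≈⟨ +-assoc x z (- z) ⟨
  (x + z) - z     ≤⟨ +-monoˡ-≤ (- z) p ⟩
  (y + z) - z     ≈⟨ +-assoc y z (- z) ⟩
  y + (z - z)     ≈⟨ +-congˡ y (+-inverseʳ z) ⟩
  y + zeroG       ≈⟨ +-identityʳ y ⟩
  y               ∎
  where open ≤-Reasoning

+-cancelˡ-≤ : ∀ {x y} z → z + x ≤ z + y → x ≤ y
+-cancelˡ-≤ {x} {y} z p = +-cancelʳ-≤ z (≤-trans (+-comm-≤ x z) (≤-trans p (+-comm-≤ z y)))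

+-monoˡ-< : ∀ {x x′} y → x < x′ → x + y < x′ + y
+-monoˡ-< y (p , x′≰x) = +-monoˡ-≤ y p , λ q → x′≰x (+-cancelʳ-≤ y q)

+-monoʳ-< : ∀ x {y y′} → y < y′ → x + y < x + y′
+-monoʳ-< x (p , y′≰y) = +-monoʳ-≤ x p , λ q → y′≰y (+-cancelˡ-≤ x q)

+-mono-≤-< : ∀ {x x′ y y′} → x ≤ x′ → y < y′ → x + y < x′ + y′
+-mono-≤-< {x′ = x′} {y = y} p q = ≤-<-trans (+-monoˡ-≤ y p) (+-monoʳ-< x′ q)

+-sub-cancel : ∀ x y → (x + y) - y ≈ x
+-sub-cancel x y = ≈-trans (+-assoc x y (- y)) (≈-trans (+-congˡ x (+-inverseʳ y)) (+-identityʳ x))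

sub-+-cancel : ∀ x y → (x - y) + y ≈ x
sub-+-cancel x y = ≈-trans (+-assoc x (- y) y) (≈-trans (+-congˡ x (+-inverseˡ y)) (+-identityʳ x))

<-sub⇒+-< : ∀ {x y} z → x < y - z → x + z < y
<-sub⇒+-< {y = y} z p = <-≤-trans (+-monoˡ-< z p) (proj₁ (sub-+-cancel y z))

sub-≤⇒≤-+ : ∀ {x y} z → y - z ≤ x → y ≤ x + z
sub-≤⇒≤-+ {y = y} z p = ≤-trans (proj₂ (sub-+-cancel y z)) (+-monoˡ-≤ z p)

+-swap-middle : ∀ a b c d → (a + b) + (c + d) ≈ (a + c) + (b + d)
+-swap-middle a b c d = begin-equality
  (a + b) + (c + d)  ≈⟨ +-assoc a b (c + d) ⟩
  a + (b + (c + d))  ≈⟨ +-congˡ a (+-assoc b c d) ⟨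
  a + ((b + c) + d)  ≈⟨ +-congˡ a (+-congʳ d (+-comm b c)) ⟩
  a + ((c + b) + d)  ≈⟨ +-congˡ a (+-assoc c b d) ⟩
  a + (c + (b + d))  ≈⟨ +-assoc a c (b + d) ⟨
  (a + c) + (b + d)  ∎
  where open ≤-Reasoning

-- Numbers

left-number : ∀ {x l} → IsNumber x → l ∈ lefts x → IsNumber l
left-number (num nl _ _) = lookupAll nl

right-number : ∀ {x r} → IsNumber x → r ∈ rights x → IsNumber r
right-number (num _ nr _) = lookupAll nr

options-ordered : ∀ {x l r} → IsNumber x → l ∈ lefts x → r ∈ rights x → l < r
options-ordered (num _ _ lt) = lt

number-options : ∀ x → IsNumber x → All (_≤ x) (lefts x) × All (x ≤_) (rights x)
number-options = game-ind _ λ x ihL ihR nx →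
  tabulateAll (λ m → ≤⁺ (tabulateAll λ m′ → ⧏⁺ˡ m (lookupAll (proj₁ (ihL m (left-number nx m))) m′))
                        (tabulateAll λ m′ → <⇒⧏ (options-ordered nx m m′))) ,
  tabulateAll (λ m → ≤⁺ (tabulateAll λ m′ → <⇒⧏ (options-ordered nx m′ m))
                        (tabulateAll λ m′ → ⧏⁺ʳ m (lookupAll (proj₂ (ihR m (right-number nx m))) m′)))

left<number : ∀ {x l} → IsNumber x → l ∈ lefts x → l < x
left<number {x} n m = lookupAll (proj₁ (number-options x n)) m , ⧏⇒≱ (⧏⁺ˡ m (≤-refl _))

number<right : ∀ {x r} → IsNumber x → r ∈ rights x → x < r
number<right {x} n m = lookupAll (proj₂ (number-options x n)) m , ⧏⇒≱ (⧏⁺ʳ m (≤-refl _))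

≤⊎>-number : ∀ {x y} → IsNumber x → IsNumber y → x ≤ y ⊎ y < x
≤⊎>-number {x} {y} nx ny with ≤⊎⧏ x y
... | inj₁ x≤y = inj₁ x≤y
... | inj₂ y⧏x with ⧏⁻ y⧏x
...   | inj₁ (_ , m , y≤l) = inj₂ (≤-<-trans y≤l (left<number nx m))
...   | inj₂ (_ , m , r≤x) = inj₂ (<-≤-trans (number<right ny m) r≤x)

≮⇒≥-number : ∀ {x y} → IsNumber x → IsNumber y → ¬ (x < y) → y ≤ x
≮⇒≥-number nx ny x≮y with ≤⊎>-number ny nx
... | inj₁ y≤x = y≤x
... | inj₂ x<y = ⊥-elim (x≮y x<y)

zero-number : IsNumber zeroG
zero-number = num [] [] λ ()

neg-number : ∀ x → IsNumber x → IsNumber (- x)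
neg-number = game-ind _ step
  where
  step : ∀ x → (∀ {l} → l ∈ lefts x → IsNumber l → IsNumber (- l)) →
         (∀ {r} → r ∈ rights x → IsNumber r → IsNumber (- r)) → IsNumber x → IsNumber (- x)
  step ⟨ L ∣ R ⟩ ihL ihR (num nl nr lt) =
    num (neg-left-elim ⟨ L ∣ R ⟩ λ m → ihR m (lookupAll nr m))
        (neg-right-elim ⟨ L ∣ R ⟩ λ m → ihL m (lookupAll nl m))
        ordered
    where
    ordered : ∀ {g h} → g ∈ negs R → h ∈ negs L → g < h
    ordered g∈ h∈ with ∈-negs⁻ R g∈ | ∈-negs⁻ L h∈
    ... | _ , r∈ , refl | _ , l∈ , refl = neg-antimono-< (lt l∈ r∈)

+-number : ∀ x y → IsNumber x → IsNumber y → IsNumber (x + y)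
+-number = game-ind (λ x → ∀ y → IsNumber x → IsNumber y → IsNumber (x + y)) λ x ixL ixR →
  game-ind (λ y → IsNumber x → IsNumber y → IsNumber (x + y)) λ y iyL iyR nx ny →
    number⁺ (+-left-elim x y (λ m → ixL m y (left-number nx m) ny) (λ m → iyL m nx (left-number ny m)))
          (+-right-elim x y (λ m → ixR m y (right-number nx m) ny) (λ m → iyR m nx (right-number ny m)))
          (ordered nx ny)
  where
  number⁺ : ∀ {x} → All IsNumber (lefts x) → All IsNumber (rights x) →
          (∀ {l r} → l ∈ lefts x → r ∈ rights x → l < r) → IsNumber x
  number⁺ {⟨ _ ∣ _ ⟩} = num
  ordered : ∀ {x y} → IsNumber x → IsNumber y → ∀ {u v} → u ∈ lefts (x + y) → v ∈ rights (x + y) → u < v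
  ordered {x} {y} nx ny u∈ v∈ with +-left⁻ x y u∈ | +-right⁻ x y v∈
  ... | inj₁ (_ , l∈ , refl) | inj₁ (_ , r∈ , refl) = +-monoˡ-< y (options-ordered nx l∈ r∈)
  ... | inj₁ (_ , l∈ , refl) | inj₂ (_ , r∈ , refl) =
    <-trans (+-monoˡ-< y (left<number nx l∈)) (+-monoʳ-< x (number<right ny r∈))
  ... | inj₂ (_ , l∈ , refl) | inj₁ (_ , r∈ , refl) =
    <-trans (+-monoʳ-< x (left<number ny l∈)) (+-monoˡ-< y (number<right nx r∈))
  ... | inj₂ (_ , l∈ , refl) | inj₂ (_ , r∈ , refl) = +-monoʳ-< x (options-ordered ny l∈ r∈)

-- Dyadic rationals

pow2inv-lefts : ∀ j → lefts (pow2inv j) ≡ [ zeroG ]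
pow2inv-lefts zero = refl
pow2inv-lefts (suc _) = refl

0⧏pow2inv : ∀ j → zeroG ⧏ pow2inv j
0⧏pow2inv j = ⧏⁺ˡ (subst (zeroG ∈_) (sym (pow2inv-lefts j)) (here refl)) (≤-refl zeroG)

0≤pow2inv : ∀ j → zeroG ≤ pow2inv j
0≤pow2inv zero = ≤⁺ [] []
0≤pow2inv (suc j) = ≤⁺ [] (0⧏pow2inv j ∷ [])

0<pow2inv : ∀ j → zeroG < pow2inv j
0<pow2inv j = 0≤pow2inv j , ⧏⇒≱ (0⧏pow2inv j)

pow2inv-number : ∀ j → IsNumber (pow2inv j)
pow2inv-number zero = num (zero-number ∷ []) [] λ _ ()
pow2inv-number (suc j) = num (zero-number ∷ []) (pow2inv-number j ∷ []) λ { (here refl) (here refl) → 0<pow2inv j }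

pow2inv-suc< : ∀ j → pow2inv (suc j) < pow2inv j
pow2inv-suc< j = number<right (pow2inv-number (suc j)) (here refl)

pow2inv-antimono-≤ : ∀ {i j} → i ≤ℕ j → pow2inv j ≤ pow2inv i
pow2inv-antimono-≤ {j = zero} z≤n = ≤-refl _
pow2inv-antimono-≤ {j = suc j} i≤1+j with ℕ.m≤n⇒m<n∨m≡n i≤1+j
... | inj₁ (s≤s i≤j) = ≤-trans (<⇒≤ (pow2inv-suc< j)) (pow2inv-antimono-≤ i≤j)
... | inj₂ refl = ≤-refl _

x<x+pow2inv : ∀ x j → x < x + pow2inv j
x<x+pow2inv x j = <-respˡ-≈ (+-identityʳ x) (+-monoʳ-< x (0<pow2inv j))

pow2inv-half : ∀ j → pow2inv (suc j) + pow2inv (suc j) ≈ pow2inv j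
half⧏rights : ∀ j → All (pow2inv (suc j) + pow2inv (suc j) ⧏_) (rights (pow2inv j))

pow2inv-half j =
  ≤⁺ (below (+-identityˡ h) ∷ below (+-identityʳ h) ∷ []) (half⧏rights j) ,
  ≤⁺ (subst (All (_⧏ h + h)) (sym (pow2inv-lefts j)) (0⧏h+h ∷ []))
     (above (≤-refl _) ∷ above (+-comm-≤ _ _) ∷ [])
  where
  h = pow2inv (suc j)
  below : ∀ {g} → g ≈ h → g ⧏ pow2inv j
  below g≈h = <⇒⧏ (<-respˡ-≈ (≈-sym g≈h) (pow2inv-suc< j))
  above : ∀ {g} → pow2inv j + h ≤ g → pow2inv j ⧏ g
  above p = <⇒⧏ (<-≤-trans (x<x+pow2inv (pow2inv j) (suc j)) p)
  0⧏h+h : zeroG ⧏ h + h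
  0⧏h+h = ⧏⁺ˡ (+-leftˡ h h (here refl)) (≤-trans (0≤pow2inv (suc j)) (proj₂ (+-identityˡ h)))

half⧏rights zero = []
half⧏rights (suc k) =
  ⧏⁺ʳ (+-rightʳ h h (here refl))
      (≤-trans (+-monoˡ-≤ _ (<⇒≤ (pow2inv-suc< (suc k)))) (proj₁ (pow2inv-half k))) ∷ []
  where
  h = pow2inv (suc (suc k))

infixr 7 _·_
_·_ : ℕ → Game → Game
zero · x = zeroG
suc n · x = n · x + x

·-distrib-+ℕ : ∀ p q x → (p +ℕ q) · x ≈ p · x + q · x
·-distrib-+ℕ p zero x rewrite ℕ.+-identityʳ p = ≈-sym (+-identityʳ (p · x))
·-distrib-+ℕ p (suc q) x rewrite ℕ.+-suc p q =
  ≈-trans (+-congʳ x (·-distrib-+ℕ p q x)) (+-assoc (p · x) (q · x) x)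

·-cong : ∀ p {x y} → x ≈ y → p · x ≈ p · y
·-cong zero _ = ≈-refl zeroG
·-cong (suc p) x≈y = +-cong (·-cong p x≈y) x≈y

·-distrib-+ : ∀ p x y → p · (x + y) ≈ p · x + p · y
·-distrib-+ zero x y = ≈-sym (+-identityʳ zeroG)
·-distrib-+ (suc p) x y = ≈-trans (+-congʳ (x + y) (·-distrib-+ p x y)) (+-swap-middle (p · x) (p · y) x y)

0≤· : ∀ p {x} → zeroG ≤ x → zeroG ≤ p · x
0≤· zero _ = ≤-refl zeroG
0≤· (suc p) 0≤x = ≤-trans (proj₂ (+-identityʳ zeroG)) (+-mono-≤ (0≤· p 0≤x) 0≤x)

0<suc· : ∀ p {x} → zeroG < x → zeroG < suc p · x
0<suc· p 0<x = ≤-<-trans (proj₂ (+-identityʳ zeroG)) (+-mono-≤-< (0≤· p (<⇒≤ 0<x)) 0<x)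

·-monoˡ-≤ : ∀ {p q x} → zeroG ≤ x → p ≤ℕ q → p · x ≤ q · x
·-monoˡ-≤ {p} {x = x} 0≤x p≤q with ℕ.m≤n⇒∃[o]m+o≡n p≤q
... | d , refl = ≤-trans (proj₂ (+-identityʳ (p · x)))
                   (≤-trans (+-monoʳ-≤ (p · x) (0≤· d 0≤x)) (proj₂ (·-distrib-+ℕ p d x)))

·-monoˡ-< : ∀ {p q x} → zeroG < x → p <ℕ q → p · x < q · x
·-monoˡ-< {p} {x = x} 0<x p<q with ℕ.m≤n⇒∃[o]m+o≡n p<q
... | d , refl = subst (λ n → p · x < n · x) (ℕ.+-suc p d)
                   (<-respʳ-≈ (≈-sym (·-distrib-+ℕ p (suc d) x))
                     (<-respˡ-≈ (+-identityʳ (p · x)) (+-monoʳ-< (p · x) (0<suc· d 0<x))))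

sub-+-cancel-middle : ∀ a b c → (a - b) + (b + c) ≈ a + c
sub-+-cancel-middle a b c = begin-equality
  (a - b) + (b + c)  ≈⟨ +-assoc a (- b) (b + c) ⟩
  a + (- b + (b + c)) ≈⟨ +-congˡ a (+-assoc (- b) b c) ⟨
  a + ((- b + b) + c) ≈⟨ +-congˡ a (+-congʳ c (+-inverseˡ b)) ⟩
  a + (zeroG + c)    ≈⟨ +-congˡ a (+-identityˡ c) ⟩
  a + c              ∎
  where open ≤-Reasoning

multipleDiff : Game → ℕ → ℕ → Game
multipleDiff x p q = p · x - q · x

+-cancelʳ-< : ∀ {x y} z → x + z < y + z → x < y
+-cancelʳ-< z (p , y+z≰x+z) = +-cancelʳ-≤ z p , λ y≤x → y+z≰x+z (+-monoˡ-≤ z y≤x)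

multipleDiff-shift : ∀ x p q r → multipleDiff x p q + (q · x + r · x) ≈ (p +ℕ r) · x
multipleDiff-shift x p q r = ≈-trans (sub-+-cancel-middle (p · x) (q · x) (r · x)) (≈-sym (·-distrib-+ℕ p r x))

multipleDiff-shift′ : ∀ x p q r → multipleDiff x p q + (r · x + q · x) ≈ (p +ℕ r) · x
multipleDiff-shift′ x p q r = ≈-trans (+-congˡ _ (+-comm (r · x) (q · x))) (multipleDiff-shift x p q r)

multipleDiff-mono-≤ : ∀ {x} p q p′ q′ → zeroG ≤ x → p +ℕ q′ ≤ℕ p′ +ℕ q →
  multipleDiff x p q ≤ multipleDiff x p′ q′
multipleDiff-mono-≤ {x} p q p′ q′ 0≤x h = +-cancelʳ-≤ (q · x + q′ · x) (begin
  multipleDiff x p q + (q · x + q′ · x)    ≈⟨ multipleDiff-shift x p q q′ ⟩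
  (p +ℕ q′) · x                            ≤⟨ ·-monoˡ-≤ 0≤x h ⟩
  (p′ +ℕ q) · x                            ≈⟨ multipleDiff-shift′ x p′ q′ q ⟨
  multipleDiff x p′ q′ + (q · x + q′ · x)  ∎)
  where open ≤-Reasoning

multipleDiff-mono-< : ∀ {x} p q p′ q′ → zeroG < x → p +ℕ q′ <ℕ p′ +ℕ q →
  multipleDiff x p q < multipleDiff x p′ q′
multipleDiff-mono-< {x} p q p′ q′ 0<x h = +-cancelʳ-< (q · x + q′ · x)
  (<-respˡ-≈ (≈-sym (multipleDiff-shift x p q q′))
    (<-respʳ-≈ (≈-sym (multipleDiff-shift′ x p′ q′ q)) (·-monoˡ-< 0<x h)))

multipleDiff-cong : ∀ {x} p q p′ q′ → zeroG ≤ x → p +ℕ q′ ≡ p′ +ℕ q →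
  multipleDiff x p q ≈ multipleDiff x p′ q′
multipleDiff-cong p q p′ q′ 0≤x e =
  multipleDiff-mono-≤ p q p′ q′ 0≤x (ℕ.≤-reflexive e) ,
  multipleDiff-mono-≤ p′ q′ p q 0≤x (ℕ.≤-reflexive (sym e))

multipleDiff-+ : ∀ x p q p′ q′ →
  multipleDiff x p q + multipleDiff x p′ q′ ≈ multipleDiff x (p +ℕ p′) (q +ℕ q′)
multipleDiff-+ x p q p′ q′ = ≈-trans (+-swap-middle (p · x) (- (q · x)) (p′ · x) (- (q′ · x)))
  (+-cong (≈-sym (·-distrib-+ℕ p p′ x))
          (subst (_≈ - ((q +ℕ q′) · x)) (neg-distrib-+ (q · x) (q′ · x))
                 (neg-cong (≈-sym (·-distrib-+ℕ q q′ x)))))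

multipleDiff-neg : ∀ x p q → - multipleDiff x p q ≈ multipleDiff x q p
multipleDiff-neg x p q =
  subst (_≈ multipleDiff x q p)
        (sym (trans (neg-distrib-+ (p · x) (- (q · x))) (cong (λ w → - (p · x) + w) (neg-involutive (q · x)))))
        (+-comm (- (p · x)) (q · x))

double-multiple-half : ∀ p j → (p +ℕ p) · pow2inv (suc j) ≈ p · pow2inv j
double-multiple-half p j = begin-equality
  (p +ℕ p) · h           ≈⟨ ·-distrib-+ℕ p p h ⟩
  p · h + p · h          ≈⟨ ·-distrib-+ p h h ⟨
  p · (h + h)            ≈⟨ ·-cong p (pow2inv-half j) ⟩
  p · pow2inv j          ∎
  where
  open ≤-Reasoning
  h = pow2inv (suc j)

multipleDiff-half : ∀ j p q → multipleDiff (pow2inv (suc j)) (p +ℕ p) (q +ℕ q) ≈ multipleDiff (pow2inv j) p q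
multipleDiff-half j p q = +-cong (double-multiple-half p j) (neg-cong (double-multiple-half q j))

Coarse : ℕ → Game → Set
Coarse j x = All (λ l → l + pow2inv j ≤ x) (lefts x) × All (λ r → x + pow2inv j ≤ r) (rights x)

coarse-zero : ∀ j → Coarse j zeroG
coarse-zero j = [] , []

coarse-pow2inv : ∀ j → Coarse j (pow2inv j)
coarse-pow2inv zero = proj₁ (+-identityˡ (pow2inv zero)) ∷ [] , []
coarse-pow2inv (suc j) = proj₁ (+-identityˡ (pow2inv (suc j))) ∷ [] , proj₁ (pow2inv-half j) ∷ []

coarse-weaken : ∀ {i j} x → i ≤ℕ j → Coarse i x → Coarse j x
coarse-weaken x i≤j (cl , cr) =
  tabulateAll (λ m → ≤-trans (+-monoʳ-≤ _ (pow2inv-antimono-≤ i≤j)) (lookupAll cl m)) ,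
  tabulateAll (λ m → ≤-trans (+-monoʳ-≤ x (pow2inv-antimono-≤ i≤j)) (lookupAll cr m))

coarse-+ : ∀ j x y → Coarse j x → Coarse j y → Coarse j (x + y)
coarse-+ j x y (cxl , cxr) (cyl , cyr) =
  +-left-elim x y (λ m → move-right (lookupAll cxl m))
                  (λ m → ≤-trans (proj₁ (+-assoc x _ d)) (+-monoʳ-≤ x (lookupAll cyl m))) ,
  +-right-elim x y (λ m → move-left (lookupAll cxr m))
                   (λ m → ≤-trans (proj₁ (+-assoc x y d)) (+-monoʳ-≤ x (lookupAll cyr m)))
  where
  d = pow2inv j
  swap : ∀ a → (a + y) + d ≈ (a + d) + y
  swap a = begin-equality
    (a + y) + d  ≈⟨ +-assoc a y d ⟩
    a + (y + d)  ≈⟨ +-congˡ a (+-comm y d) ⟩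
    a + (d + y)  ≈⟨ +-assoc a d y ⟨
    (a + d) + y  ∎
    where open ≤-Reasoning
  move-right : ∀ {l} → l + d ≤ x → (l + y) + d ≤ x + y
  move-right p = ≤-trans (proj₁ (swap _)) (+-monoˡ-≤ y p)
  move-left : ∀ {r} → x + d ≤ r → (x + y) + d ≤ r + y
  move-left p = ≤-trans (proj₁ (swap x)) (+-monoˡ-≤ y p)

coarse-neg : ∀ j x → Coarse j x → Coarse j (- x)
coarse-neg j x (cl , cr) =
  neg-left-elim x (λ m → flip (lookupAll cr m)) ,
  neg-right-elim x (λ m → flip (lookupAll cl m))
  where
  d = pow2inv j
  flip : ∀ {a b} → a + d ≤ b → - b + d ≤ - a
  flip {a} {b} p = begin
    - b + d          ≤⟨ +-monoˡ-≤ d (neg-antimono-≤ p) ⟩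
    - (a + d) + d    ≡⟨ cong (_+ d) (neg-distrib-+ a d) ⟩
    (- a + - d) + d  ≈⟨ +-assoc (- a) (- d) d ⟩
    - a + (- d + d)  ≈⟨ +-congˡ (- a) (+-inverseˡ d) ⟩
    - a + zeroG      ≈⟨ +-identityʳ (- a) ⟩
    - a              ∎
    where open ≤-Reasoning

coarse-· : ∀ j p x → Coarse j x → Coarse j (p · x)
coarse-· j zero x _ = coarse-zero j
coarse-· j (suc p) x c = coarse-+ j (p · x) x (coarse-· j p x c) c

coarse-multipleDiff : ∀ j p q → Coarse j (multipleDiff (pow2inv j) p q)
coarse-multipleDiff j p q =
  coarse-+ j _ _ (coarse-· j p _ (coarse-pow2inv j)) (coarse-neg j _ (coarse-· j q _ (coarse-pow2inv j)))

dyadic : ℕ → ℤ → Game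
dyadic E (+ p) = multipleDiff (pow2inv E) p 0
dyadic E -[1+ q ] = multipleDiff (pow2inv E) 0 (suc q)

ℤ-as-diff : ∀ n → ∃₂ λ p q → n ≡ + p ℤ.- + q
ℤ-as-diff (+ p) = p , 0 , sym (ℤ.+-identityʳ (+ p))
ℤ-as-diff -[1+ q ] = 0 , suc q , refl

private
  diff-+-cancelʳ : ∀ x y k → (x ℤ.- y) ℤ.+ (y ℤ.+ k) ≡ x ℤ.+ k
  diff-+-cancelʳ = solve-∀

  diff-+-cancelˡ : ∀ x y k → (x ℤ.- y) ℤ.+ (k ℤ.+ y) ≡ x ℤ.+ k
  diff-+-cancelˡ = solve-∀

  diff-+-cancel : ∀ x y → (x ℤ.- y) ℤ.+ y ≡ x
  diff-+-cancel = solve-∀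

  neg-+-cancel : ∀ y z → y ≡ (ℤ.- z ℤ.+ y) ℤ.+ z
  neg-+-cancel = solve-∀

≡-diff⇒+≡ : ∀ {n x y : ℤ} → n ≡ x ℤ.- y → n ℤ.+ y ≡ x
≡-diff⇒+≡ {y = y} refl = diff-+-cancel _ y

dyadic-as-diff : ∀ E {n} p q → n ≡ + p ℤ.- + q → dyadic E n ≈ multipleDiff (pow2inv E) p q
dyadic-as-diff E {+ a} p q n≡ = multipleDiff-cong a 0 p q (0≤pow2inv E)
  (trans (ℤ.+-injective (≡-diff⇒+≡ {y = + q} n≡)) (sym (ℕ.+-identityʳ p)))
dyadic-as-diff E { -[1+ b ]} p q n≡ = multipleDiff-cong 0 (suc b) p q (0≤pow2inv E)
  (ℤ.+-injective (trans (neg-+-cancel (+ q) (+ suc b)) (cong (ℤ._+ + suc b) (≡-diff⇒+≡ {x = + p} {+ q} n≡))))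

module _ {n m : ℤ} (p q p′ q′ : ℕ) (n≡ : n ≡ + p ℤ.- + q) (m≡ : m ≡ + p′ ℤ.- + q′) where
  private
    shift-n : n ℤ.+ (+ q ℤ.+ + q′) ≡ + (p +ℕ q′)
    shift-n = trans (cong (ℤ._+ (+ q ℤ.+ + q′)) n≡) (diff-+-cancelʳ (+ p) (+ q) (+ q′))
    shift-m : m ℤ.+ (+ q ℤ.+ + q′) ≡ + (p′ +ℕ q)
    shift-m = trans (cong (ℤ._+ (+ q ℤ.+ + q′)) m≡) (diff-+-cancelˡ (+ p′) (+ q′) (+ q))

  diff-≤⇒≤ℕ : n ℤ.≤ m → p +ℕ q′ ≤ℕ p′ +ℕ q
  diff-≤⇒≤ℕ n≤m = ℤ.drop‿+≤+ (subst₂ ℤ._≤_ shift-n shift-m (ℤ.+-monoˡ-≤ (+ q ℤ.+ + q′) n≤m))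

  diff-<⇒<ℕ : n ℤ.< m → p +ℕ q′ <ℕ p′ +ℕ q
  diff-<⇒<ℕ n<m = ℤ.drop‿+<+ (subst₂ ℤ._<_ shift-n shift-m (ℤ.+-monoˡ-< (+ q ℤ.+ + q′) n<m))

dyadic-mono-≤ : ∀ E {n m} → n ℤ.≤ m → dyadic E n ≤ dyadic E m
dyadic-mono-≤ E {n} {m} n≤m with ℤ-as-diff n | ℤ-as-diff m
... | p , q , n≡ | p′ , q′ , m≡ = begin
  dyadic E n                      ≈⟨ dyadic-as-diff E p q n≡ ⟩
  multipleDiff (pow2inv E) p q    ≤⟨ multipleDiff-mono-≤ p q p′ q′ (0≤pow2inv E)
                                                          (diff-≤⇒≤ℕ p q p′ q′ n≡ m≡ n≤m) ⟩
  multipleDiff (pow2inv E) p′ q′  ≈⟨ dyadic-as-diff E p′ q′ m≡ ⟨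
  dyadic E m                      ∎
  where open ≤-Reasoning

dyadic-mono-< : ∀ E {n m} → n ℤ.< m → dyadic E n < dyadic E m
dyadic-mono-< E {n} {m} n<m with ℤ-as-diff n | ℤ-as-diff m
... | p , q , n≡ | p′ , q′ , m≡ =
  <-respˡ-≈ (≈-sym (dyadic-as-diff E p q n≡)) (<-respʳ-≈ (≈-sym (dyadic-as-diff E p′ q′ m≡))
    (multipleDiff-mono-< p q p′ q′ (0<pow2inv E) (diff-<⇒<ℕ p q p′ q′ n≡ m≡ n<m)))

dyadic-cancel-< : ∀ E {n m} → dyadic E n < dyadic E m → n ℤ.< m
dyadic-cancel-< E p = ℤ.≰⇒> λ m≤n → proj₂ p (dyadic-mono-≤ E m≤n)

dyadic-+ : ∀ E n m → dyadic E n + dyadic E m ≈ dyadic E (n ℤ.+ m)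
dyadic-+ E n m with ℤ-as-diff n | ℤ-as-diff m
... | p , q , n≡ | p′ , q′ , m≡ = begin-equality
  dyadic E n + dyadic E m              ≈⟨ +-cong (dyadic-as-diff E p q n≡) (dyadic-as-diff E p′ q′ m≡) ⟩
  multipleDiff δ p q + multipleDiff δ p′ q′ ≈⟨ multipleDiff-+ δ p q p′ q′ ⟩
  multipleDiff δ (p +ℕ p′) (q +ℕ q′)   ≈⟨ dyadic-as-diff E (p +ℕ p′) (q +ℕ q′) sum≡ ⟨
  dyadic E (n ℤ.+ m)                   ∎
  where
  open ≤-Reasoning
  δ = pow2inv E
  diffs-+ : ∀ a b c d → (a ℤ.- b) ℤ.+ (c ℤ.- d) ≡ (a ℤ.+ c) ℤ.- (b ℤ.+ d)
  diffs-+ = solve-∀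
  sum≡ : n ℤ.+ m ≡ + (p +ℕ p′) ℤ.- + (q +ℕ q′)
  sum≡ = trans (cong₂ ℤ._+_ n≡ m≡) (diffs-+ (+ p) (+ q) (+ p′) (+ q′))

dyadic-half : ∀ E n → dyadic (suc E) (n ℤ.+ n) ≈ dyadic E n
dyadic-half E n with ℤ-as-diff n
... | p , q , n≡ = begin-equality
  dyadic (suc E) (n ℤ.+ n)                              ≈⟨ dyadic-as-diff (suc E) (p +ℕ p) (q +ℕ q) double≡ ⟩
  multipleDiff (pow2inv (suc E)) (p +ℕ p) (q +ℕ q)      ≈⟨ multipleDiff-half E p q ⟩
  multipleDiff (pow2inv E) p q                          ≈⟨ dyadic-as-diff E p q n≡ ⟨
  dyadic E n                                            ∎
  where
  open ≤-Reasoning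
  diff-double : ∀ a b → (a ℤ.- b) ℤ.+ (a ℤ.- b) ≡ (a ℤ.+ a) ℤ.- (b ℤ.+ b)
  diff-double = solve-∀
  double≡ : n ℤ.+ n ≡ + (p +ℕ p) ℤ.- + (q +ℕ q)
  double≡ = trans (cong₂ ℤ._+_ n≡ n≡) (diff-double (+ p) (+ q))

dyadic-neg : ∀ E n → - dyadic E n ≈ dyadic E (ℤ.- n)
dyadic-neg E n with ℤ-as-diff n
... | p , q , n≡ = begin-equality
  - dyadic E n                    ≈⟨ neg-cong (dyadic-as-diff E p q n≡) ⟩
  - multipleDiff (pow2inv E) p q  ≈⟨ multipleDiff-neg (pow2inv E) p q ⟩
  multipleDiff (pow2inv E) q p    ≈⟨ dyadic-as-diff E q p neg≡ ⟨
  dyadic E (ℤ.- n)                ∎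
  where
  open ≤-Reasoning
  neg-diff : ∀ a b → ℤ.- (a ℤ.- b) ≡ b ℤ.- a
  neg-diff = solve-∀
  neg≡ : ℤ.- n ≡ + q ℤ.- + p
  neg≡ = trans (cong ℤ.-_ n≡) (neg-diff (+ p) (+ q))

dyadic-zero : ∀ E → dyadic E (+ 0) ≈ zeroG
dyadic-zero E = +-identityʳ zeroG

dyadic-one : ∀ E → dyadic E (+ 1) ≈ pow2inv E
dyadic-one E = ≈-trans (+-identityʳ (zeroG + pow2inv E)) (+-identityˡ (pow2inv E))

dyadic-suc : ∀ E n → dyadic E n + pow2inv E ≈ dyadic E (n ℤ.+ + 1)
dyadic-suc E n = ≈-trans (+-congˡ (dyadic E n) (≈-sym (dyadic-one E))) (dyadic-+ E n (+ 1))

dyadic-coarse : ∀ E n → Coarse E (dyadic E n)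
dyadic-coarse E (+ p) = coarse-multipleDiff E p 0
dyadic-coarse E -[1+ q ] = coarse-multipleDiff E 0 (suc q)

·-number : ∀ p {x} → IsNumber x → IsNumber (p · x)
·-number zero _ = zero-number
·-number (suc p) {x} nx = +-number (p · x) x (·-number p nx) nx

multipleDiff-number : ∀ {x} p q → IsNumber x → IsNumber (multipleDiff x p q)
multipleDiff-number {x} p q nx = +-number _ _ (·-number p nx) (neg-number _ (·-number q nx))

dyadic-number : ∀ E n → IsNumber (dyadic E n)
dyadic-number E (+ p) = multipleDiff-number p 0 (pow2inv-number E)
dyadic-number E -[1+ q ] = multipleDiff-number 0 (suc q) (pow2inv-number E)

⧏⇒<-number : ∀ {x y} → IsNumber x → IsNumber y → x ⧏ y → x < y
⧏⇒<-number nx ny x⧏y with ≤⊎>-number nx ny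
... | inj₁ x≤y = x≤y , ⧏⇒≱ x⧏y
... | inj₂ y<x = ⊥-elim (⧏⇒≱ x⧏y (<⇒≤ y<x))

-- Every number is a dyadic rational

≈-cut : ∀ {L R y} → All (_⧏ y) L → All (y ⧏_) R →
  All (λ g → Any (g ≤_) L) (lefts y) → All (λ g → Any (_≤ g) R) (rights y) → ⟨ L ∣ R ⟩ ≈ y
≈-cut L⧏y y⧏R dl dr = ≤⁺ L⧏y (All.map lfR dr) , ≤⁺ (All.map lfL dl) y⧏R

left<-≈-number : ∀ {X l y} → IsNumber l → IsNumber y → l ∈ lefts X → X ≈ y → l < y
left<-≈-number nl ny m X≈y = ⧏⇒<-number nl ny (⧏-≤-trans (⧏⁺ˡ m (≤-refl _)) (proj₁ X≈y))

right>-≈-number : ∀ {X r y} → IsNumber r → IsNumber y → r ∈ rights X → X ≈ y → y < r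
right>-≈-number nr ny m X≈y = ⧏⇒<-number ny nr (≤-⧏-trans (proj₂ X≈y) (⧏⁺ʳ m (≤-refl _)))

ℤ-parity : ∀ l → ∃ λ h → (l ≡ h ℤ.+ h) ⊎ (l ≡ (h ℤ.+ h) ℤ.+ + 1)
ℤ-parity l =
  l ℤ./ℕ 2 , from-remainder (l ℤ.%ℕ 2) (l ℤ./ℕ 2) (ℤ.n%ℕd<d l 2) (ℤ.a≡a%ℕn+[a/ℕn]*n l 2)
  where
  even : ∀ h → + 0 ℤ.+ h ℤ.* + 2 ≡ h ℤ.+ h
  even = solve-∀
  odd : ∀ h → + 1 ℤ.+ h ℤ.* + 2 ≡ (h ℤ.+ h) ℤ.+ + 1
  odd = solve-∀
  from-remainder : ∀ r h → r <ℕ 2 → l ≡ + r ℤ.+ h ℤ.* + 2 →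
                   (l ≡ h ℤ.+ h) ⊎ (l ≡ (h ℤ.+ h) ℤ.+ + 1)
  from-remainder 0 h _ e = inj₁ (trans e (even h))
  from-remainder 1 h _ e = inj₂ (trans e (odd h))
  from-remainder (suc (suc _)) _ (s≤s (s≤s ()))

i<i+1 : ∀ i → i ℤ.< i ℤ.+ + 1
i<i+1 i = ℤ.suc[i]≤j⇒i<j (ℤ.≤-reflexive (ℤ.+-comm (+ 1) i))

i<j⇒i+1≤j : ∀ {i j} → i ℤ.< j → i ℤ.+ + 1 ℤ.≤ j
i<j⇒i+1≤j {i} i<j = subst (ℤ._≤ _) (ℤ.+-comm (+ 1) i) (ℤ.i<j⇒suc[i]≤j i<j)

i+1≤j⇒i<j : ∀ {i j} → i ℤ.+ + 1 ℤ.≤ j → i ℤ.< j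
i+1≤j⇒i<j {i} i+1≤j = ℤ.suc[i]≤j⇒i<j (subst (ℤ._≤ _) (ℤ.+-comm i (+ 1)) i+1≤j)

double-cancel-< : ∀ {i j} → i ℤ.+ i ℤ.< j ℤ.+ j → i ℤ.< j
double-cancel-< 2i<2j = ℤ.≰⇒> λ j≤i → ℤ.<⇒≱ 2i<2j (ℤ.+-mono-≤ j≤i j≤i)

private
  double-+1 : ∀ i → (i ℤ.+ + 1) ℤ.+ (i ℤ.+ + 1) ≡ ((i ℤ.+ i) ℤ.+ + 1) ℤ.+ + 1
  double-+1 = solve-∀

  +1+1 : ∀ i → (i ℤ.+ + 1) ℤ.+ + 1 ≡ i ℤ.+ + 2
  +1+1 = solve-∀

ℤ-floor-half : ∀ l → ∃ λ h → h ℤ.+ h ℤ.≤ l × l ℤ.≤ (h ℤ.+ h) ℤ.+ + 1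
ℤ-floor-half l with ℤ-parity l
... | h , inj₁ refl = h , ℤ.≤-refl , ℤ.<⇒≤ (i<i+1 (h ℤ.+ h))
... | h , inj₂ refl = h , ℤ.<⇒≤ (i<i+1 (h ℤ.+ h)) , ℤ.≤-refl

ℤ-ceil-half : ∀ r → ∃ λ h → r ℤ.≤ h ℤ.+ h × h ℤ.+ h ℤ.≤ r ℤ.+ + 1
ℤ-ceil-half r with ℤ-parity r
... | h , inj₁ refl = h , ℤ.≤-refl , ℤ.<⇒≤ (i<i+1 (h ℤ.+ h))
... | h , inj₂ refl = h ℤ.+ + 1 ,
  subst ((h ℤ.+ h) ℤ.+ + 1 ℤ.≤_) (sym (double-+1 h)) (ℤ.<⇒≤ (i<i+1 ((h ℤ.+ h) ℤ.+ + 1))) ,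
  ℤ.≤-reflexive (double-+1 h)

ℤ-+-cancelʳ-≤ : ∀ {i j} k → i ℤ.+ k ℤ.≤ j ℤ.+ k → i ℤ.≤ j
ℤ-+-cancelʳ-≤ k i+k≤j+k = ℤ.≮⇒≥ λ j<i → ℤ.<⇒≱ (ℤ.+-monoˡ-< k j<i) i+k≤j+k

i<i+2 : ∀ i → i ℤ.< i ℤ.+ + 2
i<i+2 i = subst (i ℤ.<_) (+1+1 i) (ℤ.<-trans (i<i+1 i) (i<i+1 (i ℤ.+ + 1)))

¬i+2≤j⇒j≤i+1 : ∀ {i j} → ¬ (i ℤ.+ + 2 ℤ.≤ j) → j ℤ.≤ i ℤ.+ + 1
¬i+2≤j⇒j≤i+1 {i} {j} i+2≰j =
  ℤ-+-cancelʳ-≤ (+ 1) (subst (j ℤ.+ + 1 ℤ.≤_) (sym (+1+1 i)) (i<j⇒i+1≤j (ℤ.≰⇒> i+2≰j)))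

width-one : ∀ {l r} → l ℤ.< r → ¬ (l ℤ.+ + 2 ℤ.≤ r) → r ≡ l ℤ.+ + 1
width-one {l} l<r l+2≰r = ℤ.≤-antisym (¬i+2≤j⇒j≤i+1 {l} l+2≰r) (i<j⇒i+1≤j l<r)

halves-< : ∀ {l r l′ r′} → l ℤ.+ + 2 ℤ.≤ r → l′ ℤ.+ l′ ℤ.≤ l → r ℤ.≤ r′ ℤ.+ r′ → l′ ℤ.< r′
halves-< {l} wide l′-low r′-high = double-cancel-< (begin-strict
  _          ≤⟨ l′-low ⟩
  l          <⟨ i<i+2 l ⟩
  l ℤ.+ + 2  ≤⟨ wide ⟩
  _          ≤⟨ r′-high ⟩
  _          ∎)
  where open ℤ.≤-Reasoning

<-double : ∀ {l l′ m} → l ℤ.≤ (l′ ℤ.+ l′) ℤ.+ + 1 → l′ ℤ.< m → l ℤ.< m ℤ.+ m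
<-double {l} {l′} {m} l-low l′<m = begin-strict
  l                               ≤⟨ l-low ⟩
  (l′ ℤ.+ l′) ℤ.+ + 1             <⟨ i<i+1 _ ⟩
  ((l′ ℤ.+ l′) ℤ.+ + 1) ℤ.+ + 1   ≡⟨ double-+1 l′ ⟨
  (l′ ℤ.+ + 1) ℤ.+ (l′ ℤ.+ + 1)   ≤⟨ ℤ.+-mono-≤ (i<j⇒i+1≤j l′<m) (i<j⇒i+1≤j l′<m) ⟩
  m ℤ.+ m                         ∎
  where open ℤ.≤-Reasoning

double-< : ∀ {r r′ m} → r′ ℤ.+ r′ ℤ.≤ r ℤ.+ + 1 → m ℤ.< r′ → m ℤ.+ m ℤ.< r
double-< {r} {r′} {m} r′-high m<r′ = i+1≤j⇒i<j (ℤ-+-cancelʳ-≤ (+ 1) (begin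
  ((m ℤ.+ m) ℤ.+ + 1) ℤ.+ + 1   ≡⟨ double-+1 m ⟨
  (m ℤ.+ + 1) ℤ.+ (m ℤ.+ + 1)   ≤⟨ ℤ.+-mono-≤ (i<j⇒i+1≤j m<r′) (i<j⇒i+1≤j m<r′) ⟩
  r′ ℤ.+ r′                     ≤⟨ r′-high ⟩
  r ℤ.+ + 1                     ∎))
  where open ℤ.≤-Reasoning

adjacent-halves : ∀ {l r l′ r′ n} →
  l ℤ.+ + 2 ℤ.≤ r → l′ ℤ.+ l′ ℤ.≤ l → r ℤ.≤ r′ ℤ.+ r′ → r′ ℤ.≤ l′ ℤ.+ + 1 →
  l′ ℤ.+ l′ ℤ.< n → n ℤ.< r′ ℤ.+ r′ → l ℤ.< n × n ℤ.< r
adjacent-halves {l} {r} {l′} {r′} {n} wide l′-low r′-high r′≤l′+1 l′<n n<r′ =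
  ℤ.≤-<-trans l≤2l′ l′<n , ℤ.<-≤-trans n<r′ 2r′≤r
  where
  open ℤ.≤-Reasoning
  2r′≤2l′+2 : r′ ℤ.+ r′ ℤ.≤ (l′ ℤ.+ l′) ℤ.+ + 2
  2r′≤2l′+2 = begin
    r′ ℤ.+ r′                       ≤⟨ ℤ.+-mono-≤ r′≤l′+1 r′≤l′+1 ⟩
    (l′ ℤ.+ + 1) ℤ.+ (l′ ℤ.+ + 1)   ≡⟨ double-+1 l′ ⟩
    ((l′ ℤ.+ l′) ℤ.+ + 1) ℤ.+ + 1   ≡⟨ +1+1 (l′ ℤ.+ l′) ⟩
    (l′ ℤ.+ l′) ℤ.+ + 2             ∎
  l≤2l′ : l ℤ.≤ l′ ℤ.+ l′
  l≤2l′ = ℤ-+-cancelʳ-≤ (+ 2) (ℤ.≤-trans wide (ℤ.≤-trans r′-high 2r′≤2l′+2))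
  2r′≤r : r′ ℤ.+ r′ ℤ.≤ r
  2r′≤r = ℤ.≤-trans 2r′≤2l′+2 (ℤ.≤-trans (ℤ.+-monoˡ-≤ (+ 2) l′-low) wide)

dyadic-left≤ : ∀ E n {g} → g ∈ lefts (dyadic E (n ℤ.+ + 1)) → g ≤ dyadic E n
dyadic-left≤ E n m =
  +-cancelʳ-≤ (pow2inv E) (≤-trans (lookupAll (proj₁ (dyadic-coarse E (n ℤ.+ + 1))) m) (proj₂ (dyadic-suc E n)))

dyadic-right≥ : ∀ E n {g} → g ∈ rights (dyadic E n) → dyadic E (n ℤ.+ + 1) ≤ g
dyadic-right≥ E n m = ≤-trans (proj₂ (dyadic-suc E n)) (lookupAll (proj₂ (dyadic-coarse E n)) m)

dyadic-raise : ∀ {E K} → E ≤′ K → ∀ n → ∃ λ m → dyadic E n ≈ dyadic K m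
dyadic-raise ≤′-refl n = n , ≈-refl _
dyadic-raise (≤′-step E≤K) n with dyadic-raise E≤K n
... | m , e = m ℤ.+ m , ≈-trans e (≈-sym (dyadic-half _ m))

≈-from-options : ∀ {L R L′ R′} →
  All (λ l → Any (l ≤_) L′) L → All (λ l′ → Any (l′ ≤_) L) L′ →
  All (λ r → Any (_≤ r) R′) R → All (λ r′ → Any (_≤ r′) R) R′ → ⟨ L ∣ R ⟩ ≈ ⟨ L′ ∣ R′ ⟩
≈-from-options L≤L′ L′≤L R′≤R R≤R′ =
  ≤⁺ (All.map lfL L≤L′) (All.map lfR R≤R′) , ≤⁺ (All.map lfL L′≤L) (All.map lfR R′≤R)

cut-neighbours : ∀ E n {xl xr} → xl ≈ dyadic E n → xr ≈ dyadic E ((n ℤ.+ + 1) ℤ.+ + 1) →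
  ⟨ [ xl ] ∣ [ xr ] ⟩ ≈ dyadic E (n ℤ.+ + 1)
cut-neighbours E n xl≈ xr≈ = ≈-cut
  (<⇒⧏ (<-respˡ-≈ (≈-sym xl≈) (dyadic-mono-< E (i<i+1 n))) ∷ [])
  (<⇒⧏ (<-respʳ-≈ (≈-sym xr≈) (dyadic-mono-< E (i<i+1 (n ℤ.+ + 1)))) ∷ [])
  (tabulateAll λ m → here (≤-trans (dyadic-left≤ E n m) (proj₂ xl≈)))
  (tabulateAll λ m → here (≤-trans (proj₁ xr≈) (dyadic-right≥ E (n ℤ.+ + 1) m)))

lefts-+ : ∀ x y → lefts x ≡ [] → lefts y ≡ [] → lefts (x + y) ≡ []
lefts-+ ⟨ [] ∣ _ ⟩ ⟨ [] ∣ _ ⟩ refl refl = refl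

rights-+ : ∀ x y → rights x ≡ [] → rights y ≡ [] → rights (x + y) ≡ []
rights-+ ⟨ _ ∣ [] ⟩ ⟨ _ ∣ [] ⟩ refl refl = refl

lefts-neg : ∀ x → rights x ≡ [] → lefts (- x) ≡ []
lefts-neg ⟨ _ ∣ [] ⟩ refl = refl

rights-· : ∀ p → rights (p · pow2inv 0) ≡ []
rights-· zero = refl
rights-· (suc p) = rights-+ (p · pow2inv 0) _ (rights-· p) refl

nonneg-integer-rights : ∀ p → rights (dyadic 0 (+ p)) ≡ []
nonneg-integer-rights p = rights-+ (p · pow2inv 0) zeroG (rights-· p) refl

negative-integer-lefts : ∀ t → lefts (dyadic 0 -[1+ t ]) ≡ []
negative-integer-lefts t =
  lefts-+ zeroG (- (suc t · pow2inv 0)) refl (lefts-neg (suc t · pow2inv 0) (rights-· (suc t)))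

dyadicCut : ℕ → ℤ → ℤ → Game
dyadicCut K l r = ⟨ [ dyadic K l ] ∣ [ dyadic K r ] ⟩

dyadicCut-bounds : ∀ K l r {y} → IsNumber y → dyadicCut K l r ≈ y → dyadic K l < y × y < dyadic K r
dyadicCut-bounds K l r ny e =
  left<-≈-number (dyadic-number K l) ny (here refl) e , right>-≈-number (dyadic-number K r) ny (here refl) e

integer-cut-nonneg : ∀ p r → + p ℤ.+ + 2 ℤ.≤ r → dyadicCut 0 (+ p) r ≈ dyadic 0 (+ p ℤ.+ + 1)
integer-cut-nonneg p r wide = ≈-cut
  (<⇒⧏ (dyadic-mono-< 0 (i<i+1 (+ p))) ∷ [])
  (<⇒⧏ (dyadic-mono-< 0 (i+1≤j⇒i<j {+ p ℤ.+ + 1} (subst (ℤ._≤ r) (sym (+1+1 (+ p))) wide))) ∷ [])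
  (tabulateAll λ m → here (dyadic-left≤ 0 (+ p) m))
  (subst (All _) (sym (nonneg-integer-rights (p +ℕ 1))) [])

integer-cut-neg : ∀ l t → l ℤ.+ + 2 ℤ.≤ -[1+ t ] ℤ.+ + 1 →
  dyadicCut 0 l (-[1+ t ] ℤ.+ + 1) ≈ dyadic 0 -[1+ t ]
integer-cut-neg l t wide = ≈-cut
  (<⇒⧏ (dyadic-mono-< 0 l<v) ∷ [])
  (<⇒⧏ (dyadic-mono-< 0 (i<i+1 -[1+ t ])) ∷ [])
  (subst (All _) (sym (negative-integer-lefts t)) [])
  (tabulateAll λ m → here (dyadic-right≥ 0 -[1+ t ] m))
  where
  l<v : l ℤ.< -[1+ t ]
  l<v = i+1≤j⇒i<j (ℤ-+-cancelʳ-≤ (+ 1) (subst (ℤ._≤ -[1+ t ] ℤ.+ + 1) (sym (+1+1 l)) wide))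

integer-cut-straddle : ∀ a s → dyadicCut 0 -[1+ a ] (+ suc s) ≈ dyadic 0 (+ 0)
integer-cut-straddle a s = ≈-cut
  (<⇒⧏ (dyadic-mono-< 0 { -[1+ a ]} {+ 0} ℤ.-<+) ∷ [])
  (<⇒⧏ (dyadic-mono-< 0 {+ 0} {+ suc s} (ℤ.+<+ (s≤s z≤n))) ∷ []) [] []

dyadicCut-halve : ∀ k {l r} l′ r′ {v} → l′ ℤ.+ l′ ℤ.≤ l → r ℤ.≤ r′ ℤ.+ r′ →
  dyadicCut k l′ r′ ≈ dyadic (suc k) v → l ℤ.< v → v ℤ.< r → dyadicCut (suc k) l r ≈ dyadic (suc k) v
dyadicCut-halve k l′ r′ l′-low r′-high e l<v v<r = ≈-trans (≈-cut
  (<⇒⧏ (<-respʳ-≈ (≈-sym e) (dyadic-mono-< (suc k) l<v)) ∷ [])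
  (<⇒⧏ (<-respˡ-≈ (≈-sym e) (dyadic-mono-< (suc k) v<r)) ∷ [])
  (here (≤-trans (proj₂ (dyadic-half k l′)) (dyadic-mono-≤ (suc k) l′-low)) ∷ [])
  (here (≤-trans (dyadic-mono-≤ (suc k) r′-high) (proj₁ (dyadic-half k r′))) ∷ [])) e

-- At a positive level the cut of l and r equals the coarser cut of ⌊l/2⌋ and ⌈r/2⌉, because the
-- value of the latter lies strictly between l/2^(k+1) and r/2^(k+1) (halves-value).
dyadicCut-wide : ∀ K l r → l ℤ.+ + 2 ℤ.≤ r → ∃ λ n → dyadicCut K l r ≈ dyadic K n
dyadicCut-dyadic : ∀ K l r → l ℤ.< r → ∃ λ n → dyadicCut K l r ≈ dyadic (suc K) n
halves-value : ∀ k l r l′ r′ → l ℤ.+ + 2 ℤ.≤ r →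
  l′ ℤ.+ l′ ℤ.≤ l → l ℤ.≤ (l′ ℤ.+ l′) ℤ.+ + 1 → r ℤ.≤ r′ ℤ.+ r′ → r′ ℤ.+ r′ ℤ.≤ r ℤ.+ + 1 →
  ∃ λ v → dyadicCut k l′ r′ ≈ dyadic (suc k) v × l ℤ.< v × v ℤ.< r

dyadicCut-wide zero (+ p) r wide = + p ℤ.+ + 1 , integer-cut-nonneg p r wide
dyadicCut-wide zero -[1+ a ] (+ zero) wide = -[1+ 0 ] , integer-cut-neg -[1+ a ] 0 wide
dyadicCut-wide zero -[1+ a ] (+ suc s) _ = + 0 , integer-cut-straddle a s
dyadicCut-wide zero -[1+ a ] -[1+ s ] wide = -[1+ suc s ] , integer-cut-neg -[1+ a ] (suc s) wide
dyadicCut-wide (suc k) l r wide with ℤ-floor-half l | ℤ-ceil-half r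
... | l′ , l′-low , l′-high | r′ , r′-high , r′-low
  with halves-value k l r l′ r′ wide l′-low l′-high r′-high r′-low
...   | v , e , l<v , v<r = v , dyadicCut-halve k l′ r′ l′-low r′-high e l<v v<r

halves-value k l r l′ r′ wide l′-low l′-high r′-high r′-low with l′ ℤ.+ + 2 ℤ.≤? r′
... | yes wide′ with dyadicCut-wide k l′ r′ wide′
...   | m , e with dyadicCut-bounds k l′ r′ (dyadic-number k m) e
...     | l′<m , m<r′ = m ℤ.+ m , ≈-trans e (≈-sym (dyadic-half k m)) ,
  <-double {l} {l′} {m} l′-high (dyadic-cancel-< k {l′} {m} l′<m) ,
  double-< {r} {r′} {m} r′-low (dyadic-cancel-< k {m} {r′} m<r′)
halves-value k l r l′ r′ wide l′-low l′-high r′-high r′-low | no narrow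
  with dyadicCut-dyadic k l′ r′ (halves-< {l} {r} wide l′-low r′-high)
... | n , e with dyadicCut-bounds k l′ r′ (dyadic-number (suc k) n) e
...   | l′<n , n<r′ = n , e ,
  adjacent-halves {l} {r} {l′} {r′} wide l′-low r′-high (¬i+2≤j⇒j≤i+1 {l′} narrow)
  (dyadic-cancel-< (suc k) {l′ ℤ.+ l′} {n} (<-respˡ-≈ (≈-sym (dyadic-half k l′)) l′<n))
  (dyadic-cancel-< (suc k) {n} {r′ ℤ.+ r′} (<-respʳ-≈ (≈-sym (dyadic-half k r′)) n<r′))

dyadicCut-dyadic K l r l<r with l ℤ.+ + 2 ℤ.≤? r
... | yes wide with dyadicCut-wide K l r wide
...   | n , e = n ℤ.+ n , ≈-trans e (≈-sym (dyadic-half K n))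
dyadicCut-dyadic K l r l<r | no narrow with width-one l<r narrow
... | refl = (l ℤ.+ l) ℤ.+ + 1 ,
  cut-neighbours (suc K) (l ℤ.+ l) (≈-sym (dyadic-half K l))
    (subst (λ n → dyadic K (l ℤ.+ + 1) ≈ dyadic (suc K) n) (double-+1 l) (≈-sym (dyadic-half K (l ℤ.+ + 1))))

integer-above : ∀ K l → ∃ λ c → ⟨ [ dyadic K l ] ∣ [] ⟩ ≈ dyadic 0 c
integer-above zero (+ p) = + p ℤ.+ + 1 , ≈-cut
  (<⇒⧏ (dyadic-mono-< 0 (i<i+1 (+ p))) ∷ []) []
  (tabulateAll λ m → here (dyadic-left≤ 0 (+ p) m))
  (subst (All _) (sym (nonneg-integer-rights (p +ℕ 1))) [])
integer-above zero -[1+ a ] = + 0 , ≈-cut (<⇒⧏ (dyadic-mono-< 0 { -[1+ a ]} {+ 0} ℤ.-<+) ∷ []) [] [] []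
integer-above (suc k) l with ℤ-floor-half l
... | l′ , l′-low , l′-high with integer-above k l′
... | c , e with dyadic-raise (ℕ.≤⇒≤′ z≤n) c
... | m , c≈m = c , ≈-trans cut≈cut′ e
  where
  cut′≈m : ⟨ [ dyadic k l′ ] ∣ [] ⟩ ≈ dyadic k m
  cut′≈m = ≈-trans e c≈m
  l<m+m : l ℤ.< m ℤ.+ m
  l<m+m = <-double {l} {l′} {m} l′-high
    (dyadic-cancel-< k (left<-≈-number (dyadic-number k l′) (dyadic-number k m) (here refl) cut′≈m))
  cut≈cut′ : ⟨ [ dyadic (suc k) l ] ∣ [] ⟩ ≈ ⟨ [ dyadic k l′ ] ∣ [] ⟩
  cut≈cut′ = ≈-cut
    (<⇒⧏ (<-respʳ-≈ (≈-trans (dyadic-half k m) (≈-sym cut′≈m)) (dyadic-mono-< (suc k) l<m+m)) ∷ []) []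
    (here (≤-trans (proj₂ (dyadic-half k l′)) (dyadic-mono-≤ (suc k) l′-low)) ∷ []) []

integer-below : ∀ K r → ∃ λ c → ⟨ [] ∣ [ dyadic K r ] ⟩ ≈ dyadic 0 c
integer-below K r with integer-above K (ℤ.- r)
... | c , e = ℤ.- c , (begin-equality
  ⟨ [] ∣ [ dyadic K r ] ⟩            ≈⟨ ≈-from-options [] [] (here (proj₂ r≈) ∷ []) (here (proj₁ r≈) ∷ []) ⟩
  - ⟨ [ dyadic K (ℤ.- r) ] ∣ [] ⟩    ≈⟨ neg-cong e ⟩
  - dyadic 0 c                       ≈⟨ dyadic-neg 0 c ⟩
  dyadic 0 (ℤ.- c)                   ∎)
  where
  open ≤-Reasoning
  r≈ : dyadic K r ≈ - dyadic K (ℤ.- r)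
  r≈ = ≈-sym (subst (λ n → - dyadic K (ℤ.- r) ≈ dyadic K n) (ℤ.neg-involutive r) (dyadic-neg K (ℤ.- r)))

DyadicAt : ℕ → Game → Set
DyadicAt K g = ∃ λ n → g ≈ dyadic K n

dyadicAt-raise : ∀ {E K g} → E ≤ℕ K → DyadicAt E g → DyadicAt K g
dyadicAt-raise E≤K (n , e) with dyadic-raise (ℕ.≤⇒≤′ E≤K) n
... | m , n≈m = m , ≈-trans e n≈m

common-level : ∀ xs → All (λ g → ∃ λ E → DyadicAt E g) xs → ∃ λ K → All (DyadicAt K) xs
common-level [] [] = 0 , []
common-level (_ ∷ gs) ((E , d) ∷ ds) with common-level gs ds
... | K , ds′ = E ⊔ K , dyadicAt-raise (ℕ.m≤m⊔n E K) d ∷ All.map (dyadicAt-raise (ℕ.m≤n⊔m E K)) ds′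

max-dyadic : ∀ K {g gs} → All (DyadicAt K) (g ∷ gs) →
  ∃ λ l → Any (dyadic K l ≤_) (g ∷ gs) × All (_≤ dyadic K l) (g ∷ gs)
max-dyadic K ((n , e) ∷ []) = n , here (proj₂ e) , proj₁ e ∷ []
max-dyadic K ((n , e) ∷ ds@(_ ∷ _)) with max-dyadic K ds
... | l , witness , bound with n ℤ.≤? l
...   | yes n≤l = l , there witness , ≤-trans (proj₁ e) (dyadic-mono-≤ K n≤l) ∷ bound
...   | no n≰l = n , here (proj₂ e) ,
  proj₁ e ∷ All.map (λ p → ≤-trans p (dyadic-mono-≤ K (ℤ.<⇒≤ (ℤ.≰⇒> n≰l)))) bound

min-dyadic : ∀ K {g gs} → All (DyadicAt K) (g ∷ gs) →
  ∃ λ r → Any (_≤ dyadic K r) (g ∷ gs) × All (dyadic K r ≤_) (g ∷ gs)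
min-dyadic K ((n , e) ∷ []) = n , here (proj₁ e) , proj₂ e ∷ []
min-dyadic K ((n , e) ∷ ds@(_ ∷ _)) with min-dyadic K ds
... | r , witness , bound with r ℤ.≤? n
...   | yes r≤n = r , there witness , ≤-trans (dyadic-mono-≤ K r≤n) (proj₂ e) ∷ bound
...   | no r≰n = n , here (proj₁ e) ,
  proj₂ e ∷ All.map (λ p → ≤-trans (dyadic-mono-≤ K (ℤ.<⇒≤ (ℤ.≰⇒> r≰n))) p) bound

cut-of-dyadics : ∀ K L R → All (DyadicAt K) L → All (DyadicAt K) R →
  (∀ {l r} → l ∈ L → r ∈ R → l < r) → ∃ λ E → DyadicAt E ⟨ L ∣ R ⟩
cut-of-dyadics K [] [] _ _ _ = 0 , + 0 , ≈-sym (dyadic-zero 0)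
cut-of-dyadics K L@(_ ∷ _) [] dL _ _ with max-dyadic K dL
... | l , witness , bound with integer-above K l
...   | c , e = 0 , c , ≈-trans (≈-from-options (All.map here bound) (witness ∷ []) [] []) e
cut-of-dyadics K [] R@(_ ∷ _) _ dR _ with min-dyadic K dR
... | r , witness , bound with integer-below K r
...   | c , e = 0 , c , ≈-trans (≈-from-options [] [] (All.map here bound) (witness ∷ [])) e
cut-of-dyadics K L@(_ ∷ _) R@(_ ∷ _) dL dR ordered with max-dyadic K dL | min-dyadic K dR
... | l , witnessL , boundL | r , witnessR , boundR with find witnessL | find witnessR
...   | _ , wl∈ , l≤wl | _ , wr∈ , wr≤r with dyadicCut-dyadic K l r l<r
  where
  l<r : l ℤ.< r
  l<r = dyadic-cancel-< K (≤-<-trans l≤wl (<-≤-trans (ordered wl∈ wr∈) wr≤r))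
...     | n , e = suc K , n ,
  ≈-trans (≈-from-options (All.map here boundL) (witnessL ∷ []) (All.map here boundR) (witnessR ∷ [])) e

-- Abstract because unfolding this construction during conversion checking is prohibitively expensive.
abstract
  number⇒dyadic : ∀ x → IsNumber x → ∃ λ E → DyadicAt E x
  number⇒dyadic = game-ind _ step
    where
    step : ∀ x → (∀ {l} → l ∈ lefts x → IsNumber l → ∃ λ E → DyadicAt E l) →
           (∀ {r} → r ∈ rights x → IsNumber r → ∃ λ E → DyadicAt E r) →
           IsNumber x → ∃ λ E → DyadicAt E x
    step ⟨ L ∣ R ⟩ ihL ihR nx
      with common-level (L ++ R) (All.++⁺ (tabulateAll λ m → ihL m (left-number nx m))
                                          (tabulateAll λ m → ihR m (right-number nx m)))
    ... | K , ds = cut-of-dyadics K L R (All.++⁻ˡ L ds) (All.++⁻ʳ L ds) (options-ordered nx)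

dyadic-reduced : ∀ E n → (∃ λ m → dyadic E n ≈ dyadic 0 m) ⊎
                        (∃₂ λ k h → dyadic E n ≈ dyadic (suc k) ((h ℤ.+ h) ℤ.+ + 1))
dyadic-reduced zero n = inj₁ (n , ≈-refl _)
dyadic-reduced (suc k) n with ℤ-parity n
... | h , inj₂ refl = inj₂ (k , h , ≈-refl _)
... | h , inj₁ refl with dyadic-reduced k h
...   | inj₁ (m , e) = inj₁ (m , ≈-trans (dyadic-half k h) e)
...   | inj₂ (k′ , h′ , e) = inj₂ (k′ , h′ , ≈-trans (dyadic-half k h) e)

-- G ≤ {2h/2^(k+1) | (h+1)/2^k}, the canonical cut of its value, so G ⧏ (h+1)/2^k, and only b can witness it.
right-option-near-odd-dyadic : ∀ {a b} k h → ⟨ [ a ] ∣ [ b ] ⟩ ≈ dyadic (suc k) ((h ℤ.+ h) ℤ.+ + 1) →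
  b ≤ dyadic (suc k) ((h ℤ.+ h) ℤ.+ + 1) + pow2inv (suc k)
right-option-near-odd-dyadic {a} {b} k h G≈ =
  from-cases (⧏⁻ (≤⁻ʳ (proj₁ (≈-trans G≈ (≈-sym neighbours))) (here refl)))
  where
  G = ⟨ [ a ] ∣ [ b ] ⟩
  n = (h ℤ.+ h) ℤ.+ + 1
  upper : dyadic k (h ℤ.+ + 1) ≈ dyadic (suc k) (n ℤ.+ + 1)
  upper = subst (λ n → dyadic k (h ℤ.+ + 1) ≈ dyadic (suc k) n) (double-+1 h) (≈-sym (dyadic-half k (h ℤ.+ + 1)))
  neighbours : ⟨ [ dyadic (suc k) (h ℤ.+ h) ] ∣ [ dyadic k (h ℤ.+ + 1) ] ⟩ ≈ dyadic (suc k) n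
  neighbours = cut-neighbours (suc k) (h ℤ.+ h) (≈-refl _) upper
  lower<G : dyadic k h < dyadic (suc k) n
  lower<G = <-respˡ-≈ (dyadic-half k h) (dyadic-mono-< (suc k) (i<i+1 (h ℤ.+ h)))
  from-cases : (∃ λ l → l ∈ lefts (dyadic k (h ℤ.+ + 1)) × G ≤ l) ⊎
               (∃ λ r → r ∈ [ b ] × r ≤ dyadic k (h ℤ.+ + 1)) →
               b ≤ dyadic (suc k) n + pow2inv (suc k)
  from-cases (inj₁ (_ , m , G≤l)) =
    ⊥-elim (proj₂ lower<G (≤-trans (proj₂ G≈) (≤-trans G≤l (dyadic-left≤ k h m))))
  from-cases (inj₂ (_ , here refl , b≤)) = ≤-trans b≤ (proj₁ (≈-trans upper (≈-sym (dyadic-suc (suc k) n))))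

cut-level : ∀ {a b} → IsNumber ⟨ [ a ] ∣ [ b ] ⟩ → b - ⟨ [ a ] ∣ [ b ] ⟩ ≤ pow2inv 0 →
  ∃₂ λ E n → ⟨ [ a ] ∣ [ b ] ⟩ ≈ dyadic E n × b - ⟨ [ a ] ∣ [ b ] ⟩ ≤ pow2inv E
cut-level {a} {b} nG D≤1 with number⇒dyadic _ nG
... | E₀ , n₀ , G≈₀ with dyadic-reduced E₀ n₀
...   | inj₁ (m , e) = 0 , m , ≈-trans G≈₀ e , D≤1
...   | inj₂ (k , h , e) = suc k , (h ℤ.+ h) ℤ.+ + 1 , G≈ , (begin
  b - G        ≤⟨ +-monoˡ-≤ (- G) (right-option-near-odd-dyadic k h G≈) ⟩
  (y + δ) - G  ≈⟨ +-cong (+-comm y δ) (neg-cong G≈) ⟩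
  (δ + y) - y  ≈⟨ +-sub-cancel δ y ⟩
  δ            ∎)
  where
  open ≤-Reasoning
  G = ⟨ [ a ] ∣ [ b ] ⟩
  y = dyadic (suc k) ((h ℤ.+ h) ℤ.+ + 1)
  δ = pow2inv (suc k)
  G≈ : G ≈ y
  G≈ = ≈-trans G≈₀ e

-- Greedy binary expansions

pow2inv-cancel-< : ∀ {i j} → pow2inv j < pow2inv i → i <ℕ j
pow2inv-cancel-< {i} {j} lt = ℕ.≰⇒> λ j≤i → proj₂ lt (pow2inv-antimono-≤ j≤i)

≥1⇒suc : ∀ {n} → 1 ≤ℕ n → ∃ λ m → n ≡ suc m
≥1⇒suc (s≤s _) = _ , refl

psum-nonneg : ∀ α j → zeroG ≤ psum α j
psum-nonneg α zero = ≤-refl zeroG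
psum-nonneg α (suc j) = ≤-trans (proj₂ (+-identityʳ zeroG)) (+-mono-≤ (psum-nonneg α j) (0≤pow2inv (α j)))

psum-number : ∀ α j → IsNumber (psum α j)
psum-number α zero = zero-number
psum-number α (suc j) = +-number _ _ (psum-number α j) (pow2inv-number (α j))

module Greedy {k : ℕ} {D : Game} {α : ℕ → ℕ}
  (nD : IsNumber D) (D≤1 : D ≤ pow2inv 0) (greedy : IsGreedyExpansion k D α) where

  remainder : ℕ → Game
  remainder i = D - psum α i

  α≥1 : ∀ i → suc i ≤ℕ k → 1 ≤ℕ α i
  α≥1 i i<k = proj₁ (greedy i i<k)

  pow2inv<remainder : ∀ i → suc i ≤ℕ k → pow2inv (α i) < remainder i
  pow2inv<remainder i i<k = proj₁ (proj₂ (greedy i i<k))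

  remainder≤pow2inv : ∀ i → suc i ≤ℕ k → ∀ m → α i ≡ suc m → remainder i ≤ pow2inv m
  remainder≤pow2inv i i<k zero _ =
    ≤-trans (+-monoʳ-≤ D (neg-antimono-≤ (psum-nonneg α i))) (≤-trans (proj₁ (+-identityʳ D)) D≤1)
  remainder≤pow2inv i i<k (suc m) αi≡ =
    ≮⇒≥-number (pow2inv-number (suc m)) (+-number _ _ nD (neg-number _ (psum-number α i)))
      (proj₂ (proj₂ (greedy i i<k)) (suc m) (s≤s z≤n) (subst (suc m <ℕ_) (sym αi≡) (ℕ.n<1+n (suc m))))

  remainder-suc : ∀ i → remainder (suc i) ≈ remainder i - pow2inv (α i)
  remainder-suc i = subst (λ g → D + g ≈ remainder i - pow2inv (α i))
                          (sym (neg-distrib-+ (psum α i) (pow2inv (α i))))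
                          (≈-sym (+-assoc D (- psum α i) (- pow2inv (α i))))

  α-increasing : ∀ i → suc (suc i) ≤ℕ k → α i <ℕ α (suc i)
  α-increasing i i+1<k with ≥1⇒suc (α≥1 i (ℕ.<⇒≤ i+1<k))
  ... | m , αi≡ = pow2inv-cancel-< (<-≤-trans (pow2inv<remainder (suc i) i+1<k) (begin
    remainder (suc i)                    ≈⟨ remainder-suc i ⟩
    remainder i - pow2inv (α i)          ≡⟨ cong (λ n → remainder i - pow2inv n) αi≡ ⟩
    remainder i - pow2inv (suc m)        ≤⟨ +-monoˡ-≤ _ (remainder≤pow2inv i (ℕ.<⇒≤ i+1<k) m αi≡) ⟩
    pow2inv m - pow2inv (suc m)          ≈⟨ +-congʳ _ (pow2inv-half m) ⟨
    (h + h) - h                          ≈⟨ +-sub-cancel h h ⟩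
    h                                    ≡⟨ cong pow2inv αi≡ ⟨
    pow2inv (α i)                        ∎))
    where
    open ≤-Reasoning
    h = pow2inv (suc m)

  α-monotone : ∀ {i j} → i ≤ℕ j → suc j ≤ℕ k → α i ≤ℕ α j
  α-monotone {j = zero} z≤n _ = ℕ.≤-refl
  α-monotone {i} {suc j} i≤1+j j+1<k with ℕ.m≤n⇒m<n∨m≡n i≤1+j
  ... | inj₂ refl = ℕ.≤-refl
  ... | inj₁ (s≤s i≤j) = ℕ.≤-trans (α-monotone i≤j (ℕ.<⇒≤ j+1<k)) (ℕ.<⇒≤ (α-increasing j j+1<k))

  psum-coarse : ∀ {i j} → i ≤ℕ j → suc j ≤ℕ k → Coarse (α j) (psum α i)
  psum-coarse {zero} {j} _ _ = coarse-zero (α j)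
  psum-coarse {suc i} {j} i<j j<k = coarse-+ (α j) (psum α i) (pow2inv (α i)) (psum-coarse (ℕ.<⇒≤ i<j) j<k)
    (coarse-weaken (pow2inv (α i)) (α-monotone (ℕ.<⇒≤ i<j) j<k) (coarse-pow2inv (α i)))

-- The ordinal sum G : k

-- Coarseness of P makes every Left option of P + 2^-(m+1) dominated by N and every Right option
-- dominated by b.
ordinal-step : ∀ {a b N P} m → Coarse (suc m) P → N ≈ P → a < P →
  P + pow2inv (suc m) < b → b ≤ P + pow2inv m → ⟨ a ∷ N ∷ [] ∣ [ b ] ⟩ ≈ P + pow2inv (suc m)
ordinal-step {a} {b} {N} {P} m (cl , cr) N≈P a<P P+d<b b≤P+2d = ≈-cut
  (<⇒⧏ (<-trans a<P P<P+d) ∷ <⇒⧏ (<-respˡ-≈ (≈-sym N≈P) P<P+d) ∷ [])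
  (<⇒⧏ P+d<b ∷ [])
  (+-left-elim P d (λ l∈ → there (here (≤-trans (lookupAll cl l∈) (proj₂ N≈P))))
                   (λ { (here refl) → there (here (≤-trans (proj₁ (+-identityʳ P)) (proj₂ N≈P))) }))
  (+-right-elim P d (λ r∈ → here (≤-trans b≤P+2d (+-shift-≤ (lookupAll cr r∈))))
                    (λ { (here refl) → here b≤P+2d }))
  where
  d = pow2inv (suc m)
  P<P+d : P < P + d
  P<P+d = x<x+pow2inv P (suc m)
  +-shift-≤ : ∀ {r} → P + d ≤ r → P + pow2inv m ≤ r + d
  +-shift-≤ {r} P+d≤r = begin
    P + pow2inv m  ≈⟨ +-congˡ P (pow2inv-half m) ⟨
    P + (d + d)    ≈⟨ +-assoc P d d ⟨
    (P + d) + d    ≤⟨ +-monoˡ-≤ d P+d≤r ⟩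
    r + d          ∎
    where open ≤-Reasoning

+-rotate : ∀ x p g → (x + p) + g ≈ (g + p) + x
+-rotate x p g = begin-equality
  (x + p) + g  ≈⟨ +-comm (x + p) g ⟩
  g + (x + p)  ≈⟨ +-congˡ g (+-comm x p) ⟩
  g + (p + x)  ≈⟨ +-assoc g p x ⟨
  (g + p) + x  ∎
  where open ≤-Reasoning

module OrdinalSum {a b : Game} {k : ℕ} {α : ℕ → ℕ}
  (nb : IsNumber b) (nG : IsNumber ⟨ [ a ] ∣ [ b ] ⟩) (D≤1 : b - ⟨ [ a ] ∣ [ b ] ⟩ ≤ pow2inv 0)
  (greedy : IsGreedyExpansion k (b - ⟨ [ a ] ∣ [ b ] ⟩) α) where

  G = ⟨ [ a ] ∣ [ b ] ⟩

  open Greedy (+-number b (- G) nb (neg-number G nG)) D≤1 greedy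

  private
    level = cut-level nG D≤1
    E = proj₁ level
    n = proj₁ (proj₂ level)
    y = dyadic E n
    G≈y : G ≈ y
    G≈y = proj₁ (proj₂ (proj₂ level))

  E≤α : ∀ j → suc j ≤ℕ k → E ≤ℕ α j
  E≤α j j<k = ℕ.≤-trans (ℕ.<⇒≤ (pow2inv-cancel-< α₀<E)) (α-monotone z≤n j<k)
    where
    α₀<E : pow2inv (α 0) < pow2inv E
    α₀<E = <-≤-trans (pow2inv<remainder 0 (ℕ.≤-trans (s≤s z≤n) j<k))
                     (≤-trans (proj₁ (+-identityʳ (b - G))) (proj₂ (proj₂ (proj₂ level))))

  ordinal-sum : ∀ j → j ≤ℕ k → (G ∶ natG j) ≈ G + psum α j
  ordinal-sum zero _ = ≈-sym (+-identityʳ G)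
  ordinal-sum (suc j) j<k with ≥1⇒suc (α≥1 j j<k)
  ... | m , αj≡ = begin-equality
    (G ∶ natG (suc j))     ≈⟨ ordinal-step m coarse (≈-trans (ordinal-sum j (ℕ.<⇒≤ j<k)) T≈P)
                                             a<P P+d<b b≤P+2d ⟩
    P + pow2inv (suc m)   ≡⟨ cong (λ i → P + pow2inv i) αj≡ ⟨
    P + pow2inv (α j)     ≈⟨ +-congʳ _ (≈-sym T≈P) ⟩
    T + pow2inv (α j)     ≈⟨ +-assoc G (psum α j) (pow2inv (α j)) ⟩
    G + psum α (suc j)    ∎
    where
    open ≤-Reasoning
    T = G + psum α j
    P = y + psum α j
    T≈P : T ≈ P
    T≈P = +-congʳ (psum α j) G≈y
    coarse : Coarse (suc m) P
    coarse = subst (λ i → Coarse i P) αj≡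
      (coarse-+ (α j) y (psum α j) (coarse-weaken y (E≤α j j<k) (dyadic-coarse E n)) (psum-coarse ℕ.≤-refl j<k))
    a<P : a < P
    a<P = <-≤-trans (left<number nG (here refl))
                    (≤-trans (proj₂ (+-identityʳ G)) (≤-trans (+-monoʳ-≤ G (psum-nonneg α j)) (proj₁ T≈P)))
    P+d<b : P + pow2inv (suc m) < b
    P+d<b = <-respˡ-≈ (≈-trans (+-rotate _ (psum α j) G) (+-congʳ _ T≈P))
              (<-sub⇒+-< G (<-sub⇒+-< (psum α j)
                (subst (λ i → pow2inv i < remainder j) αj≡ (pow2inv<remainder j j<k))))
    b≤P+2d : b ≤ P + pow2inv m
    b≤P+2d = ≤-trans (sub-≤⇒≤-+ G (sub-≤⇒≤-+ (psum α j) (remainder≤pow2inv j j<k m αj≡)))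
                     (proj₁ (≈-trans (+-rotate _ (psum α j) G) (+-congʳ _ T≈P)))

ordinal-sum-positive : ∀ k a b → IsNumber b → IsNumber ⟨ [ a ] ∣ [ b ] ⟩ →
  b - ⟨ [ a ] ∣ [ b ] ⟩ ≤ natG 1 → ∀ α → IsGreedyExpansion k (b - ⟨ [ a ] ∣ [ b ] ⟩) α →
  (⟨ [ a ] ∣ [ b ] ⟩ ∶ natG k) ≈ ⟨ [ a ] ∣ [ b ] ⟩ + psum α k
ordinal-sum-positive k a b nb nG D≤1 α greedy = OrdinalSum.ordinal-sum nb nG D≤1 greedy k ℕ.≤-refl

greedy-cong : ∀ {k D D′} α → D ≈ D′ → IsGreedyExpansion k D α → IsGreedyExpansion k D′ α
greedy-cong α D≈D′ greedy i i<k with greedy i i<k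
... | α≥1 , below , least = α≥1 , <-respʳ-≈ (+-congʳ _ D≈D′) below ,
  λ m m≥1 m<α lt → least m m≥1 m<α (<-respʳ-≈ (+-congʳ _ (≈-sym D≈D′)) lt)

ordinal-sum-negNat : ∀ a b k → (⟨ [ a ] ∣ [ b ] ⟩ ∶ negNatG k) ≡ - (⟨ [ - b ] ∣ [ - a ] ⟩ ∶ natG k)
ordinal-sum-negNat a b zero = cong₂ (λ l r → ⟨ [ l ] ∣ [ r ] ⟩) (sym (neg-involutive a)) (sym (neg-involutive b))
ordinal-sum-negNat a b (suc k) = cong₂ (λ l rs → ⟨ [ l ] ∣ rs ⟩) (sym (neg-involutive a))
  (cong₂ (λ r r′ → r ∷ [ r′ ]) (sym (neg-involutive b)) (ordinal-sum-negNat a b k))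

ordinal-sum-negative : ∀ k a b → IsNumber a → IsNumber ⟨ [ a ] ∣ [ b ] ⟩ →
  ⟨ [ a ] ∣ [ b ] ⟩ - a ≤ natG 1 → ∀ β → IsGreedyExpansion k (⟨ [ a ] ∣ [ b ] ⟩ - a) β →
  (⟨ [ a ] ∣ [ b ] ⟩ ∶ negNatG k) ≈ ⟨ [ a ] ∣ [ b ] ⟩ - psum β k
ordinal-sum-negative k a b na nG G-a≤1 β greedy = subst₂ _≈_ (sym (ordinal-sum-negNat a b k))
  (trans (neg-distrib-+ (- G) (psum β k)) (cong (_- psum β k) (neg-involutive G)))
  (neg-cong (ordinal-sum-positive k (- b) (- a) (neg-number a na) (neg-number G nG)
               (≤-trans (proj₂ D≈) G-a≤1) β (greedy-cong β D≈ greedy)))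
  where
  G = ⟨ [ a ] ∣ [ b ] ⟩
  D≈ : G - a ≈ (- a) - (- G)
  D≈ = subst (λ g → G - a ≈ (- a) + g) (sym (neg-involutive G)) (+-comm G (- a))

theorem4p2 : (k : ℕ) → 1 Data.Nat.≤ k → (a b : Game) →
    IsNumber a → IsNumber b → IsNumber ⟨ [ a ] ∣ [ b ] ⟩ →
    ((b - ⟨ [ a ] ∣ [ b ] ⟩ ≤ natG 1) → (α : ℕ → ℕ) →
      IsGreedyExpansion k (b - ⟨ [ a ] ∣ [ b ] ⟩) α →
      (⟨ [ a ] ∣ [ b ] ⟩ ∶ natG k) ≈ ⟨ [ a ] ∣ [ b ] ⟩ + psum α k)
    ×
    ((⟨ [ a ] ∣ [ b ] ⟩ - a ≤ natG 1) → (β : ℕ → ℕ) →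
      IsGreedyExpansion k (⟨ [ a ] ∣ [ b ] ⟩ - a) β →
      (⟨ [ a ] ∣ [ b ] ⟩ ∶ negNatG k) ≈ ⟨ [ a ] ∣ [ b ] ⟩ - psum β k)
theorem4p2 k _ a b na nb nG = ordinal-sum-positive k a b nb nG , ordinal-sum-negative k a b na nG
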